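{- Let $\mathbb{F}$ be a field with $\operatorname{char}(\mathbb{F})\neq 2$, and let $(f_n)\in\mathbf{VP}_e(\mathbb{F})$. Then there are polynomially bounded functions $p,q:\mathbb{N}\to\mathbb{N}$ such that for each $n$ some matrix $F\in Q(f_n)+\mathcal{O}(\varepsilon)$ can be written as a product of at most $p(n)$ primitive Q-matrices and has error degree at most $q(n)$.
   Context: $\mathbf{VP}_e(\mathbb{F})$ is the class of families $(f_n)$ of polynomials over $\mathbb{F}$ (in polynomially many variables) computable by arithmetic formulas (fan-in 2, gates $+,\times$, leaves variables or constants of $\mathbb{F}$) of polynomially bounded size. $\varepsilon$ is a formal variable. For a polynomial $h$ over $\mathbb{F}(\varepsilon)$, $Q(h)=\begin{pmatrix} h & 1\\ 1 & 0\end{pmatrix}$. A primitive Q-matrix is a matrix $Q(\ell)$ with $\ell$ an affine linear form in $x_1,x_2,\ldots$ with coefficients in $\mathbb{F}(\varepsilon)$. $\mathcal{O}(\varepsilon)=\varepsilon\,\mathbb{F}[\varepsilon,x_1,x_2,\ldots]$ and $M+\mathcal{O}(\varepsilon)$ is the set of matrices $M+E$ with all entries of $E$ in $\mathcal{O}(\varepsilon)$. The error degree of a matrix with entries in $\mathbb{F}[\varepsilon,x_1,x_2,\ldots]$ is the largest power of $\varepsilon$ occurring in its entries. -}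

module Defs where

open import Level using (Level; _⊔_)
open import Algebra.Bundles using (CommutativeRing)
open import Data.Nat using (ℕ; zero; suc; _≤_; _<_; _^_) renaming (_+_ to _+ℕ_; _*_ to _*ℕ_)
open import Data.Fin using (Fin; toℕ)
open import Data.Unit.Polymorphic using (⊤)
open import Data.Empty.Polymorphic using (⊥)
open import Data.Product using (Σ; ∃; _×_; _,_)
open import Relation.Nullary using (¬_)

record Field (c ℓ : Level) : Set (Level.suc (c ⊔ ℓ)) where
  field
    commutativeRing : CommutativeRing c ℓ
  open CommutativeRing commutativeRing public
  field
    0≉1     : ¬ (0# ≈ 1#)
    inverse : ∀ x → ¬ (x ≈ 0#) → Σ Carrier (λ y → (x * y) ≈ 1#)

CharNot2 : ∀ {c ℓ} → Field c ℓ → Set ℓ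
CharNot2 F = ¬ ((1# + 1#) ≈ 0#) where open Field F

PolyBounded : (ℕ → ℕ) → Set
PolyBounded g = Σ ℕ λ a → Σ ℕ λ k → ∀ n → g n ≤ a *ℕ n ^ k +ℕ a

module Over {c ℓ : Level} (F : Field c ℓ) where
  open Field F using (0#; 1#) renaming (Carrier to K; _≈_ to _≈F_; _+_ to _+F_; _*_ to _*F_; -_ to -F_)

  infixl 6 _⊕_
  infixl 7 _⊗_

  data Tm {a} (V : Set a) : Set (c ⊔ a) where
    con  : K → Tm V
    var  : V → Tm V
    _⊕_  : Tm V → Tm V → Tm V
    _⊗_  : Tm V → Tm V → Tm V
    ⊖_   : Tm V → Tm V

  ren : ∀ {a b} {V : Set a} {W : Set b} → (V → W) → Tm V → Tm W
  ren f (con k) = con k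
  ren f (var v) = var (f v)
  ren f (s ⊕ t) = ren f s ⊕ ren f t
  ren f (s ⊗ t) = ren f s ⊗ ren f t
  ren f (⊖ t)   = ⊖ ren f t

  -- Equality of the commutative F-algebra presented by the generators V
  -- and the extra relations Ax (Ax empty: the polynomial ring F[V]).
  data Eq {a b} {V : Set a} (Ax : Tm V → Tm V → Set b) : Tm V → Tm V → Set (c ⊔ ℓ ⊔ a ⊔ b) where
    ax      : ∀ {s t} → Ax s t → Eq Ax s t
    refl′   : ∀ {t} → Eq Ax t t
    sym′    : ∀ {s t} → Eq Ax s t → Eq Ax t s
    trans′  : ∀ {s t u} → Eq Ax s t → Eq Ax t u → Eq Ax s u
    ⊕-cong  : ∀ {s s′ t t′} → Eq Ax s s′ → Eq Ax t t′ → Eq Ax (s ⊕ t) (s′ ⊕ t′)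
    ⊗-cong  : ∀ {s s′ t t′} → Eq Ax s s′ → Eq Ax t t′ → Eq Ax (s ⊗ t) (s′ ⊗ t′)
    ⊖-cong  : ∀ {s s′} → Eq Ax s s′ → Eq Ax (⊖ s) (⊖ s′)
    ⊕-assoc : ∀ s t u → Eq Ax ((s ⊕ t) ⊕ u) (s ⊕ (t ⊕ u))
    ⊕-comm  : ∀ s t → Eq Ax (s ⊕ t) (t ⊕ s)
    ⊕-id    : ∀ t → Eq Ax (t ⊕ con 0#) t
    ⊕-inv   : ∀ t → Eq Ax (t ⊕ (⊖ t)) (con 0#)
    ⊗-assoc : ∀ s t u → Eq Ax ((s ⊗ t) ⊗ u) (s ⊗ (t ⊗ u))
    ⊗-comm  : ∀ s t → Eq Ax (s ⊗ t) (t ⊗ s)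
    ⊗-id    : ∀ t → Eq Ax (t ⊗ con 1#) t
    ⊗-distrib : ∀ s t u → Eq Ax (s ⊗ (t ⊕ u)) ((s ⊗ t) ⊕ (s ⊗ u))
    con-≈   : ∀ {x y} → x ≈F y → Eq Ax (con x) (con y)
    con-+   : ∀ x y → Eq Ax (con (x +F y)) (con x ⊕ con y)
    con-*   : ∀ x y → Eq Ax (con (x *F y)) (con x ⊗ con y)
    con--   : ∀ x → Eq Ax (con (-F x)) (⊖ con x)

  NoAx : ∀ {a} {V : Set a} → Tm V → Tm V → Set
  NoAx _ _ = ⊥

  _≈P_ : ∀ {a} {V : Set a} → Tm V → Tm V → Set (c ⊔ ℓ ⊔ a)
  _≈P_ = Eq NoAx

  zeroT oneT : ∀ {a} {V : Set a} → Tm V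
  zeroT = con 0#
  oneT  = con 1#

  PX : Set c
  PX = Tm ℕ

  -- F[ε]  (single generator ε = var tt)
  PE : Set c
  PE = Tm (⊤ {Level.zero})

  data VEX : Set where
    ε′ : VEX
    x′ : ℕ → VEX

  PEX : Set c
  PEX = Tm VEX

  εEX : PEX
  εEX = var ε′

  -- F(ε)[x_0, x_1, ...] presented as the localisation of F[ε, x]
  -- at the nonzero polynomials in ε alone: a generator inv p for each
  -- p ∈ F[ε], with inv p · p = 1 whenever p ≠ 0 in F[ε].
  data VL : Set c where
    ε″  : VL
    x″  : ℕ → VL
    inv : PE → VL

  PL : Set c
  PL = Tm VL

  embE : PE → PL
  embE = ren (λ _ → ε″)

  embEX : PEX → PL
  embEX = ren f where
    f : VEX → VL
    f ε′     = ε″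
    f (x′ i) = x″ i

  data AxL : PL → PL → Set (c ⊔ ℓ) where
    inv-ax : (p : PE) → ¬ (p ≈P zeroT) → AxL (var (inv p) ⊗ embE p) oneT

  _≈L_ : PL → PL → Set (c ⊔ ℓ)
  _≈L_ = Eq AxL

  record Coef : Set (c ⊔ ℓ) where
    field
      num den : PE
      den≉0   : ¬ (den ≈P zeroT)

  coefL : Coef → PL
  coefL r = embE (Coef.num r) ⊗ var (inv (Coef.den r))

  record Affine : Set (c ⊔ ℓ) where
    field
      const : Coef
      m     : ℕ
      coef  : Fin m → Coef

  sumFin : ∀ {a} {V : Set a} (m : ℕ) → (Fin m → Tm V) → Tm V
  sumFin zero    g = zeroT
  sumFin (suc m) g = g Fin.zero ⊕ sumFin m (λ i → g (Fin.suc i))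
    where import Data.Fin as Fin

  affineL : Affine → PL
  affineL A = coefL (Affine.const A)
              ⊕ sumFin (Affine.m A) (λ i → coefL (Affine.coef A i) ⊗ var (x″ (toℕ i)))

  record Mat {a} (A : Set a) : Set a where
    constructor mat
    field
      m11 m12 m21 m22 : A

  mapMat : ∀ {a b} {A : Set a} {B : Set b} → (A → B) → Mat A → Mat B
  mapMat f (mat a b c′ d) = mat (f a) (f b) (f c′) (f d)

  _·_ : ∀ {a} {V : Set a} → Mat (Tm V) → Mat (Tm V) → Mat (Tm V)
  mat a b c′ d · mat a′ b′ c″ d′ =
    mat (a ⊗ a′ ⊕ b ⊗ c″) (a ⊗ b′ ⊕ b ⊗ d′) (c′ ⊗ a′ ⊕ d ⊗ c″) (c′ ⊗ b′ ⊕ d ⊗ d′)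

  idMat : ∀ {a} {V : Set a} → Mat (Tm V)
  idMat = mat oneT zeroT zeroT oneT

  prodMat : ∀ {a} {V : Set a} (k : ℕ) → (Fin k → Mat (Tm V)) → Mat (Tm V)
  prodMat zero    M = idMat
  prodMat (suc k) M = M Fin.zero · prodMat k (λ i → M (Fin.suc i))
    where import Data.Fin as Fin

  MatRel : ∀ {a r} {A : Set a} → (A → A → Set r) → Mat A → Mat A → Set r
  MatRel R (mat a b c′ d) (mat a′ b′ c″ d′) = R a a′ × R b b′ × R c′ c″ × R d d′

  MatAll : ∀ {a r} {A : Set a} → (A → Set r) → Mat A → Set r
  MatAll P (mat a b c′ d) = P a × P b × P c′ × P d

  Q : ∀ {a} {V : Set a} → Tm V → Mat (Tm V)
  Q h = mat h oneT oneT zeroT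

  primQ : Affine → Mat PL
  primQ A = Q (affineL A)

  InOε : PEX → Set (c ⊔ ℓ)
  InOε h = Σ PEX λ g → h ≈P (εEX ⊗ g)

  _∈_+Oε : Mat PEX → Mat PEX → Set (c ⊔ ℓ)
  M ∈ N +Oε = Σ (Mat PEX) λ E → MatAll InOε E × MatRel _≈P_ M (mapMat₂ E)
    where
    mapMat₂ : Mat PEX → Mat PEX
    mapMat₂ (mat e1 e2 e3 e4) = mat (Mat.m11 N ⊕ e1) (Mat.m12 N ⊕ e2) (Mat.m21 N ⊕ e3) (Mat.m22 N ⊕ e4)

  powε : ℕ → PEX
  powε zero    = oneT
  powε (suc j) = εEX ⊗ powε j

  embX : PX → PEX
  embX = ren x′

  EpsDeg≤ : ℕ → PEX → Set (c ⊔ ℓ)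
  EpsDeg≤ d h = Σ (Fin (suc d) → PX) λ cs →
                  h ≈P sumFin (suc d) (λ j → powε (toℕ j) ⊗ embX (cs j))

  ErrorDeg≤ : ℕ → Mat PEX → Set (c ⊔ ℓ)
  ErrorDeg≤ d M = MatAll (EpsDeg≤ d) M

  data Formula : Set c where
    leafVar   : ℕ → Formula
    leafConst : K → Formula
    plus      : Formula → Formula → Formula
    times     : Formula → Formula → Formula

  size : Formula → ℕ
  size (leafVar _)   = 1
  size (leafConst _) = 1
  size (plus φ ψ)    = suc (size φ +ℕ size ψ)
  size (times φ ψ)   = suc (size φ +ℕ size ψ)

  VarsBelow : ℕ → Formula → Set
  VarsBelow v (leafVar i)   = i < v
  VarsBelow v (leafConst _) = ⊤
  VarsBelow v (plus φ ψ)    = VarsBelow v φ × VarsBelow v ψ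
  VarsBelow v (times φ ψ)   = VarsBelow v φ × VarsBelow v ψ

  eval : Formula → PX
  eval (leafVar i)   = var i
  eval (leafConst k) = con k
  eval (plus φ ψ)    = eval φ ⊕ eval ψ
  eval (times φ ψ)   = eval φ ⊗ eval ψ

  VPe : (ℕ → PX) → Set (c ⊔ ℓ)
  VPe f = Σ (ℕ → ℕ) λ v → Σ (ℕ → ℕ) λ s → PolyBounded v × PolyBounded s ×
          (∀ n → Σ Formula λ φ → size φ ≤ s n × VarsBelow (v n) φ × eval φ ≈P f n)

-- Brent's depth reduction rewrites a formula of size S as an arithmetic tree whose cost is at most 1000·S^13.
-- The tree is translated bottom-up (translate b k) into a product of primitive Q-matrices equal to Q(f) + ε^2k·E.
-- Sums are exact: Q(x)·Q(0)·Q(y) = Q(x + y).  For a product, conjugating Q(g)·Q(0) by diag(ε^k, -ε^-k), itself a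
-- product of three constant Q-matrices, gives the unipotent U(a) with a = -ε^2k·g, and transposing gives L(b)
-- with b = -ε^2k·h.  The (1,2) entry of [U(a),L(b)]·U(s)·[L(b),U(a)]·U(-s) is a·b·W with W ≡ 2s modulo (a, b);
-- for s = -1/2, which needs char F ≠ 2, rescaling by ε^-4k leaves g·h modulo ε^2k.  The conjugations eat into
-- the error exponent, so the factors are translated with 4k in place of k; as the tree has logarithmic depth,
-- the number of Q-matrices and all ε-degrees stay polynomial in S.
module Submission where

open import Defs
open import Level using (Level) renaming (_⊔_ to _⊔ˡ_)
open import Algebra.Bundles using (CommutativeRing)
open import Algebra.Structures using (IsCommutativeRing)
open import Algebra.Solver.Ring.AlmostCommutativeRing
  using (AlmostCommutativeRing; fromCommutativeRing; _-Raw-AlmostCommutative⟶_)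
import Algebra.Solver.Ring
open import Algebra.Solver.Ring using ([+]; [*])
import Algebra.Properties.Ring
import Algebra.Properties.Semiring.Mult.TCOptimised
open import Data.Nat as ℕ using (ℕ; zero; suc; _+_; _*_; _^_; _⊔_; _≤_; _<_; z≤n; s≤s; ⌈_/2⌉)
open import Data.Nat.Properties
open import Data.Nat.Induction using (<-wellFounded)
import Data.Nat.Tactic.RingSolver as ℕ-Solver
open import Algebra.Properties.CommutativeSemigroup +-commutativeSemigroup using (interchange)
open import Data.Integer as ℤ using (ℤ; +_; -[1+_])
import Data.Integer.Properties as ℤ
open import Data.Sign as Sign using (Sign)
open import Data.Fin using (Fin; toℕ; #_) renaming (zero to fzero; suc to fsuc)
open import Data.List using (List; []; _∷_; length; map)
open import Data.List.Properties using (length-map)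
open import Data.Vec using (Vec; []; _∷_; _++_; _∷ʳ_; reverse; lookup)
open import Data.Vec.Properties using (reverse-∷)
open import Data.Maybe using (Maybe; just; nothing)
open import Data.Product using (Σ; _×_; _,_; proj₁; proj₂)
open import Data.Unit.Polymorphic using (tt)
open import Induction.WellFounded using (Acc; acc)
open import Relation.Binary.Bundles using (Setoid)
import Relation.Binary.Reasoning.Setoid
open import Relation.Binary.PropositionalEquality as ≡ using (_≡_)
open import Relation.Nullary using (¬_; yes; no)

sizeBound : ℕ → ℕ
sizeBound x = 1000 * x ^ 13

sizeBound-mono : ∀ {x y} → x ≤ y → sizeBound x ≤ sizeBound y
sizeBound-mono x≤y = *-monoʳ-≤ 1000 (^-monoˡ-≤ 13 x≤y)

2≤sizeBound : ∀ x → 1 ≤ x → 2 ≤ sizeBound x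
2≤sizeBound x 1≤x = ≤-trans (m≤m+n 2 998) (*-monoʳ-≤ 1000 (^-monoˡ-≤ 13 1≤x))

^-distribʳ-* : ∀ a b n → (a * b) ^ n ≡ a ^ n * b ^ n
^-distribʳ-* a b zero    = ≡.refl
^-distribʳ-* a b (suc n) = ≡.trans (≡.cong ((a * b) *_) (^-distribʳ-* a b n)) (*-interchange a b (a ^ n) (b ^ n))
  where open import Algebra.Properties.CommutativeSemigroup *-commutativeSemigroup renaming (interchange to *-interchange)

-- Holds because 33·(3/4)^13 < 1; the proof multiplies through by 4^13.
sizeBound-step : ∀ c S → 4 * c ≤ 3 * S → 1 ≤ S → 33 * sizeBound c + 160 ≤ sizeBound S
sizeBound-step c S 4c≤3S 1≤S = *-cancelˡ-≤ (4 ^ 13) (begin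
  4 ^ 13 * (33 * sizeBound c + 160)                   ≡⟨ expand (c ^ 13) ⟩
  33000 * (4 ^ 13 * c ^ 13) + 10737418240             ≡⟨ ≡.cong (λ x → 33000 * x + 10737418240) (^-distribʳ-* 4 c 13) ⟨
  33000 * (4 * c) ^ 13 + 10737418240                  ≤⟨ +-monoˡ-≤ _ (*-monoʳ-≤ 33000 (^-monoˡ-≤ 13 4c≤3S)) ⟩
  33000 * (3 * S) ^ 13 + 10737418240                  ≡⟨ ≡.cong (λ x → 33000 * x + 10737418240) (^-distribʳ-* 3 S 13) ⟩
  33000 * (3 ^ 13 * S ^ 13) + 10737418240             ≡⟨ ≡.cong (_+ 10737418240) (*-assoc 33000 (3 ^ 13) (S ^ 13)) ⟨
  52612659000 * S ^ 13 + 10737418240                  ≤⟨ +-monoʳ-≤ _ (*-monoʳ-≤ 10737418240 (^-monoˡ-≤ 13 1≤S)) ⟩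
  52612659000 * S ^ 13 + 10737418240 * S ^ 13         ≡⟨ *-distribʳ-+ (S ^ 13) 52612659000 10737418240 ⟨
  63350077240 * S ^ 13                                ≤⟨ *-monoˡ-≤ (S ^ 13) (m≤m+n 63350077240 3758786760) ⟩
  67108864000 * S ^ 13                                ≡⟨ *-assoc (4 ^ 13) 1000 (S ^ 13) ⟩
  4 ^ 13 * sizeBound S                                ∎)
  where
  open ≤-Reasoning
  rearrange : ∀ a b c x y → a * (b * (c * x) + y) ≡ (b * c) * (a * x) + a * y
  rearrange = ℕ-Solver.solve-∀
  expand : ∀ C → 67108864 * (33 * (1000 * C) + 160) ≡ 33000 * (67108864 * C) + 10737418240
  expand C = rearrange 67108864 33 1000 C 160

private
  ⊔1-^ : ∀ x m → (x ⊔ 1) ^ m ≤ x ^ m + 1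
  ⊔1-^ x m with x ≤? 1
  ... | yes x≤1 = begin
    (x ⊔ 1) ^ m  ≡⟨ ≡.cong (_^ m) (m≤n⇒m⊔n≡n x≤1) ⟩
    1 ^ m        ≡⟨ ^-zeroˡ m ⟩
    1            ≤⟨ m≤n+m 1 (x ^ m) ⟩
    x ^ m + 1    ∎
    where open ≤-Reasoning
  ... | no x≰1  = ≤-trans (≤-reflexive (≡.cong (_^ m) (m≥n⇒m⊔n≡m (<⇒≤ (≰⇒> x≰1))))) (m≤m+n (x ^ m) 1)

PolyBounded-sizeBound : ∀ s → PolyBounded s → PolyBounded (λ n → sizeBound (s n))
PolyBounded-sizeBound s (a , k , s≤) = 1000 * (2 * a) ^ 13 , k * 13 , bound
  where
  bound : ∀ n → sizeBound (s n) ≤ 1000 * (2 * a) ^ 13 * n ^ (k * 13) + 1000 * (2 * a) ^ 13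
  bound n = begin
    1000 * s n ^ 13                          ≤⟨ *-monoʳ-≤ 1000 (^-monoˡ-≤ 13 s≤2a[x⊔1]) ⟩
    1000 * (2 * a * (x ⊔ 1)) ^ 13            ≡⟨ ≡.cong (1000 *_) (^-distribʳ-* (2 * a) (x ⊔ 1) 13) ⟩
    1000 * ((2 * a) ^ 13 * (x ⊔ 1) ^ 13)     ≡⟨ *-assoc 1000 ((2 * a) ^ 13) _ ⟨
    C * (x ⊔ 1) ^ 13                         ≤⟨ *-monoʳ-≤ C (⊔1-^ x 13) ⟩
    C * (x ^ 13 + 1)                         ≡⟨ *-distribˡ-+ C (x ^ 13) 1 ⟩
    C * x ^ 13 + C * 1                       ≡⟨ ≡.cong₂ (λ y z → C * y + z) (^-*-assoc n k 13) (*-identityʳ C) ⟩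
    C * n ^ (k * 13) + C                     ∎
    where
    open ≤-Reasoning
    x C : ℕ
    x = n ^ k
    C = 1000 * (2 * a) ^ 13
    s≤2a[x⊔1] : s n ≤ 2 * a * (x ⊔ 1)
    s≤2a[x⊔1] = begin
      s n                       ≤⟨ s≤ n ⟩
      a * x + a                 ≤⟨ +-mono-≤ (*-monoʳ-≤ a (m≤m⊔n x 1)) (≤-trans (≤-reflexive (≡.sym (*-identityʳ a))) (*-monoʳ-≤ a (m≤n⊔m x 1))) ⟩
      a * (x ⊔ 1) + a * (x ⊔ 1) ≡⟨ double a (x ⊔ 1) ⟩
      2 * a * (x ⊔ 1)           ∎
      where
      double : ∀ a y → a * y + a * y ≡ 2 * a * y
      double = ℕ-Solver.solve-∀

n≤⌈n/2⌉+⌈n/2⌉ : ∀ n → n ≤ ⌈ n /2⌉ + ⌈ n /2⌉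
n≤⌈n/2⌉+⌈n/2⌉ zero          = z≤n
n≤⌈n/2⌉+⌈n/2⌉ (suc zero)    = s≤s z≤n
n≤⌈n/2⌉+⌈n/2⌉ (suc (suc n)) = s≤s (≤-trans (s≤s (n≤⌈n/2⌉+⌈n/2⌉ n)) (≤-reflexive (≡.sym (+-suc _ _))))

4⌈n/2⌉≤3n : ∀ n → 4 * ⌈ 2 + n /2⌉ ≤ 3 * (2 + n)
4⌈n/2⌉≤3n zero          = m≤m+n 4 2
4⌈n/2⌉≤3n (suc zero)    = m≤m+n 8 1
4⌈n/2⌉≤3n (suc (suc n)) = begin
  4 * suc ⌈ 2 + n /2⌉     ≡⟨ *-suc 4 ⌈ 2 + n /2⌉ ⟩
  4 + 4 * ⌈ 2 + n /2⌉     ≤⟨ +-monoʳ-≤ 4 (4⌈n/2⌉≤3n n) ⟩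
  4 + 3 * (2 + n)         ≤⟨ +-monoˡ-≤ (3 * (2 + n)) (m≤m+n 4 2) ⟩
  6 + 3 * (2 + n)         ≡⟨ regroup n ⟩
  3 * (2 + (2 + n))       ∎
  where
  open ≤-Reasoning
  regroup : ∀ n → 6 + 3 * (2 + n) ≡ 3 * (2 + (2 + n))
  regroup = ℕ-Solver.solve-∀

-- Brent's balancing step for a formula of size S = 2 + n: cutting out a subformula of size t with t ≤ T ≤ 2t,
-- where T = ⌈S/2⌉, leaves pieces of size at most 3S/4.
module Halving (n : ℕ) where
  S T : ℕ
  S = 2 + n
  T = ⌈ S /2⌉

  1≤T : 1 ≤ T
  1≤T = s≤s z≤n

  T<S : T < S
  T<S = ⌈n/2⌉<n n

  small-sub : ∀ t → t ≤ T → 4 * t ≤ 3 * S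
  small-sub t t≤T = ≤-trans (*-monoʳ-≤ 4 t≤T) (4⌈n/2⌉≤3n n)

  small-rest : ∀ a t → a + t ≤ S → T ≤ t + t → 4 * a ≤ 3 * S
  small-rest a t a+t≤S T≤2t = +-cancelʳ-≤ S (4 * a) (3 * S) (begin
    4 * a + S                    ≤⟨ +-monoʳ-≤ (4 * a) (≤-trans (n≤⌈n/2⌉+⌈n/2⌉ S) (+-mono-≤ T≤2t T≤2t)) ⟩
    4 * a + ((t + t) + (t + t))  ≡⟨ regroup a t ⟩
    4 * (a + t)                  ≤⟨ *-monoʳ-≤ 4 a+t≤S ⟩
    4 * S                        ≡⟨ +-comm S (3 * S) ⟩
    3 * S + S                    ∎)
    where
    open ≤-Reasoning
    regroup : ∀ a t → 4 * a + ((t + t) + (t + t)) ≡ 4 * (a + t)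
    regroup = ℕ-Solver.solve-∀


module Construction {c ℓ : Level} (F : Field c ℓ) where

  open Over F
  open Field F using (0#; 1#) renaming (Carrier to K; _≈_ to _≈𝔽_; _+_ to _+𝔽_)
  private module 𝔽 = Field F

  infixl 30 _ᵀ

  _ᵀ : ∀ {a} {A : Set a} → Mat A → Mat A
  mat a b c d ᵀ = mat a c b d

  module TermRing {a b} {V : Set a} (Ax : Tm V → Tm V → Set b) where

    _≈_ : Tm V → Tm V → Set (c ⊔ˡ ℓ ⊔ˡ a ⊔ˡ b)
    _≈_ = Eq Ax

    ⊕-identityˡ : ∀ t → (con 0# ⊕ t) ≈ t
    ⊕-identityˡ t = trans′ (⊕-comm _ _) (⊕-id t)

    ⊗-identityˡ : ∀ t → (con 1# ⊗ t) ≈ t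
    ⊗-identityˡ t = trans′ (⊗-comm _ _) (⊗-id t)

    ≡⇒≈ : ∀ {s t} → s ≡ t → s ≈ t
    ≡⇒≈ ≡.refl = refl′

    sumFin-cong : ∀ m {g h : Fin m → Tm V} → (∀ j → g j ≈ h j) → sumFin m g ≈ sumFin m h
    sumFin-cong zero    p = refl′
    sumFin-cong (suc m) p = ⊕-cong (p fzero) (sumFin-cong m (λ j → p (fsuc j)))

    sumFin-zero : ∀ m {g : Fin m → Tm V} → (∀ j → g j ≈ con 0#) → sumFin m g ≈ con 0#
    sumFin-zero zero    p = refl′
    sumFin-zero (suc m) p = trans′ (⊕-cong (p fzero) (sumFin-zero m (λ j → p (fsuc j)))) (⊕-id _)

    isCommutativeRing : IsCommutativeRing _≈_ _⊕_ _⊗_ ⊖_ (con 0#) (con 1#)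
    isCommutativeRing = record
      { isRing = record
        { +-isAbelianGroup = record
          { isGroup = record
            { isMonoid = record
              { isSemigroup = record
                { isMagma = record
                  { isEquivalence = record { refl = refl′ ; sym = sym′ ; trans = trans′ }
                  ; ∙-cong = ⊕-cong }
                ; assoc = ⊕-assoc }
              ; identity = ⊕-identityˡ , ⊕-id }
            ; inverse = (λ t → trans′ (⊕-comm _ _) (⊕-inv t)) , ⊕-inv
            ; ⁻¹-cong = ⊖-cong }
          ; comm = ⊕-comm }
        ; *-cong = ⊗-cong
        ; *-assoc = ⊗-assoc
        ; *-identity = ⊗-identityˡ , ⊗-id
        ; distrib = ⊗-distrib , λ s t u →
            trans′ (⊗-comm _ _) (trans′ (⊗-distrib s t u) (⊕-cong (⊗-comm _ _) (⊗-comm _ _))) }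
      ; *-comm = ⊗-comm }

    commutativeRing : CommutativeRing (c ⊔ˡ a) (c ⊔ˡ ℓ ⊔ˡ a ⊔ˡ b)
    commutativeRing = record { isCommutativeRing = isCommutativeRing }

    open CommutativeRing commutativeRing public using (zeroˡ; zeroʳ; setoid)
    module Reasoning = Relation.Binary.Reasoning.Setoid setoid
    open Algebra.Properties.Ring (CommutativeRing.ring commutativeRing) public
      using (-0#≈0#; -‿involutive; -‿distribˡ-*; -‿distribʳ-*) renaming (-‿+-comm to ⊖-⊕-comm)
    open Algebra.Properties.Semiring.Mult.TCOptimised (CommutativeRing.semiring commutativeRing)
      using (×-homo-+; ×1-homo-*) renaming (_×_ to _×′_)

    -- The integers act on the ring; this homomorphism lets the ring solver use integer coefficients.
    fromℤ : ℤ → Tm V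
    fromℤ (+ n)    = n ×′ con 1#
    fromℤ -[1+ n ] = ⊖ (suc n ×′ con 1#)

    private
      fromℤ-⊖ : ∀ m n → fromℤ (m ℤ.⊖ n) ≈ (m ×′ con 1# ⊕ ⊖ (n ×′ con 1#))
      fromℤ-⊖ m       zero    = sym′ (trans′ (⊕-cong refl′ -0#≈0#) (⊕-id _))
      fromℤ-⊖ zero    (suc n) = sym′ (⊕-identityˡ _)
      fromℤ-⊖ (suc m) (suc n) = trans′ (≡⇒≈ (≡.cong fromℤ (ℤ.[1+m]⊖[1+n]≡m⊖n m n)))
        (trans′ (fromℤ-⊖ m n) (sym′ (trans′ (⊕-cong (×-homo-+ _ 1 m) (⊖-cong (×-homo-+ _ 1 n)))
          (cancel-one (m ×′ con 1#) (n ×′ con 1#)))))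
        where
        cancel-one : ∀ x y → ((con 1# ⊕ x) ⊕ ⊖ (con 1# ⊕ y)) ≈ (x ⊕ ⊖ y)
        cancel-one x y = begin
          (con 1# ⊕ x) ⊕ ⊖ (con 1# ⊕ y)         ≈⟨ ⊕-cong (⊕-comm _ _) (sym′ (⊖-⊕-comm _ _)) ⟩
          (x ⊕ con 1#) ⊕ (⊖ con 1# ⊕ ⊖ y)       ≈⟨ ⊕-assoc _ _ _ ⟩
          x ⊕ (con 1# ⊕ (⊖ con 1# ⊕ ⊖ y))       ≈⟨ ⊕-cong refl′ (sym′ (⊕-assoc _ _ _)) ⟩
          x ⊕ ((con 1# ⊕ ⊖ con 1#) ⊕ ⊖ y)       ≈⟨ ⊕-cong refl′ (trans′ (⊕-cong (⊕-inv _) refl′) (⊕-identityˡ _)) ⟩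
          x ⊕ ⊖ y                               ∎
          where open Reasoning

      signed : Sign → Tm V → Tm V
      signed Sign.+ x = x
      signed Sign.- x = ⊖ x

      fromℤ-◃ : ∀ s n → fromℤ (s ℤ.◃ n) ≈ signed s (n ×′ con 1#)
      fromℤ-◃ Sign.+ zero    = refl′
      fromℤ-◃ Sign.- zero    = sym′ -0#≈0#
      fromℤ-◃ Sign.+ (suc n) = refl′
      fromℤ-◃ Sign.- (suc n) = refl′

      fromℤ-signed : ∀ i → fromℤ i ≈ signed (ℤ.sign i) (ℤ.∣ i ∣ ×′ con 1#)
      fromℤ-signed (+ n)    = refl′
      fromℤ-signed -[1+ n ] = refl′

      signed-⊗ : ∀ s t x y → signed (s Sign.* t) (x ⊗ y) ≈ (signed s x ⊗ signed t y)
      signed-⊗ Sign.+ Sign.+ x y = refl′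
      signed-⊗ Sign.+ Sign.- x y = -‿distribʳ-* x y
      signed-⊗ Sign.- Sign.+ x y = -‿distribˡ-* x y
      signed-⊗ Sign.- Sign.- x y =
        sym′ (trans′ (sym′ (-‿distribˡ-* _ _)) (trans′ (⊖-cong (sym′ (-‿distribʳ-* _ _))) (-‿involutive _)))

      signed-cong : ∀ s {x y} → x ≈ y → signed s x ≈ signed s y
      signed-cong Sign.+ p = p
      signed-cong Sign.- p = ⊖-cong p

      fromℤ-⊗ : ∀ i j → fromℤ (i ℤ.* j) ≈ (fromℤ i ⊗ fromℤ j)
      fromℤ-⊗ i j = trans′ (fromℤ-◃ (ℤ.sign i Sign.* ℤ.sign j) (ℤ.∣ i ∣ ℕ.* ℤ.∣ j ∣))
        (trans′ (signed-cong (ℤ.sign i Sign.* ℤ.sign j) (×1-homo-* ℤ.∣ i ∣ ℤ.∣ j ∣))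
        (trans′ (signed-⊗ (ℤ.sign i) (ℤ.sign j) _ _) (⊗-cong (sym′ (fromℤ-signed i)) (sym′ (fromℤ-signed j)))))

      fromℤ-⊕ : ∀ i j → fromℤ (i ℤ.+ j) ≈ (fromℤ i ⊕ fromℤ j)
      fromℤ-⊕ (+ m)    (+ n)    = ×-homo-+ (con 1#) m n
      fromℤ-⊕ (+ m)    -[1+ n ] = fromℤ-⊖ m (suc n)
      fromℤ-⊕ -[1+ m ] (+ n)    = trans′ (fromℤ-⊖ n (suc m)) (⊕-comm _ _)
      fromℤ-⊕ -[1+ m ] -[1+ n ] = trans′
        (⊖-cong (trans′ (≡⇒≈ (≡.cong (λ k → k ×′ con 1#) (≡.sym (+-suc (suc m) n)))) (×-homo-+ (con 1#) (suc m) (suc n))))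
        (sym′ (⊖-⊕-comm _ _))

      fromℤ-⊖_ : ∀ i → fromℤ (ℤ.- i) ≈ (⊖ fromℤ i)
      fromℤ-⊖ (+ zero)  = sym′ -0#≈0#
      fromℤ-⊖ (+ suc n) = refl′
      fromℤ-⊖ -[1+ n ]  = sym′ (-‿involutive _)

      ring : AlmostCommutativeRing (c ⊔ˡ a) (c ⊔ˡ ℓ ⊔ˡ a ⊔ˡ b)
      ring = fromCommutativeRing commutativeRing

      fromℤ-homomorphism : ℤ.+-*-rawRing -Raw-AlmostCommutative⟶ ring
      fromℤ-homomorphism = record
        { ⟦_⟧ = fromℤ ; +-homo = fromℤ-⊕ ; *-homo = fromℤ-⊗ ; -‿homo = fromℤ-⊖_ ; 0-homo = refl′ ; 1-homo = refl′ }

      fromℤ-≟ : ∀ i j → Maybe (fromℤ i ≈ fromℤ j)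
      fromℤ-≟ i j with i ℤ.≟ j
      ... | yes ≡.refl = just refl′
      ... | no _       = nothing

    open Algebra.Solver.Ring ℤ.+-*-rawRing ring fromℤ-homomorphism fromℤ-≟ public

    infix 4 _≈M_
    _≈M_ : Mat (Tm V) → Mat (Tm V) → Set (c ⊔ˡ ℓ ⊔ˡ a ⊔ˡ b)
    _≈M_ = MatRel _≈_

    ≈M-refl : ∀ {X} → X ≈M X
    ≈M-refl {mat _ _ _ _} = refl′ , refl′ , refl′ , refl′

    ≈M-sym : ∀ {X Y} → X ≈M Y → Y ≈M X
    ≈M-sym {mat _ _ _ _} {mat _ _ _ _} (p , q , r , s) = sym′ p , sym′ q , sym′ r , sym′ s

    ≈M-trans : ∀ {X Y Z} → X ≈M Y → Y ≈M Z → X ≈M Z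
    ≈M-trans {mat _ _ _ _} {mat _ _ _ _} {mat _ _ _ _} (p , q , r , s) (p′ , q′ , r′ , s′) =
      trans′ p p′ , trans′ q q′ , trans′ r r′ , trans′ s s′

    matSetoid : Setoid (c ⊔ˡ a) (c ⊔ˡ ℓ ⊔ˡ a ⊔ˡ b)
    matSetoid = record
      { Carrier = Mat (Tm V) ; _≈_ = _≈M_
      ; isEquivalence = record { refl = ≈M-refl ; sym = ≈M-sym ; trans = ≈M-trans } }

    module MatReasoning = Relation.Binary.Reasoning.Setoid matSetoid

    sumFin-⊗ˡ : ∀ x m {g : Fin m → Tm V} → sumFin m (λ j → x ⊗ g j) ≈ (x ⊗ sumFin m g)
    sumFin-⊗ˡ x zero    = sym′ (zeroʳ x)
    sumFin-⊗ˡ x (suc m) = trans′ (⊕-cong refl′ (sumFin-⊗ˡ x m)) (sym′ (⊗-distrib _ _ _))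

    ·-cong : ∀ {X X′ Y Y′} → X ≈M X′ → Y ≈M Y′ → (X · Y) ≈M (X′ · Y′)
    ·-cong {mat _ _ _ _} {mat _ _ _ _} {mat _ _ _ _} {mat _ _ _ _} (p , q , r , s) (p′ , q′ , r′ , s′) =
      ⊕-cong (⊗-cong p p′) (⊗-cong q r′) , ⊕-cong (⊗-cong p q′) (⊗-cong q s′) ,
      ⊕-cong (⊗-cong r p′) (⊗-cong s r′) , ⊕-cong (⊗-cong r q′) (⊗-cong s s′)

    ·-assoc : ∀ X Y Z → ((X · Y) · Z) ≈M (X · (Y · Z))
    ·-assoc (mat a b c d) (mat e f g h) (mat i j k l) =
      entry a b i k , entry a b j l , entry c d i k , entry c d j l
      where
      entry : ∀ a b c d → ((a ⊗ e ⊕ b ⊗ g) ⊗ c ⊕ (a ⊗ f ⊕ b ⊗ h) ⊗ d) ≈ (a ⊗ (e ⊗ c ⊕ f ⊗ d) ⊕ b ⊗ (g ⊗ c ⊕ h ⊗ d))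
      entry a b c d = solve 8 (λ a b c d e f g h →
        (a :* e :+ b :* g) :* c :+ (a :* f :+ b :* h) :* d := a :* (e :* c :+ f :* d) :+ b :* (g :* c :+ h :* d))
        refl′ a b c d e f g h

    ·-identityˡ : ∀ X → (idMat · X) ≈M X
    ·-identityˡ (mat a b c d) = upper a c , upper b d , lower a c , lower b d
      where
      upper : ∀ x y → (con 1# ⊗ x ⊕ con 0# ⊗ y) ≈ x
      upper = solve 2 (λ x y → con (+ 1) :* x :+ con (+ 0) :* y := x) refl′
      lower : ∀ x y → (con 0# ⊗ x ⊕ con 1# ⊗ y) ≈ y
      lower = solve 2 (λ x y → con (+ 0) :* x :+ con (+ 1) :* y := y) refl′

    ·-identityʳ : ∀ X → (X · idMat) ≈M X
    ·-identityʳ (mat a b c d) = left a b , right a b , left c d , right c d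
      where
      left : ∀ x y → (x ⊗ con 1# ⊕ y ⊗ con 0#) ≈ x
      left = solve 2 (λ x y → x :* con (+ 1) :+ y :* con (+ 0) := x) refl′
      right : ∀ x y → (x ⊗ con 0# ⊕ y ⊗ con 1#) ≈ y
      right = solve 2 (λ x y → x :* con (+ 0) :+ y :* con (+ 1) := y) refl′

    ᵀ-cong : ∀ {X Y} → X ≈M Y → X ᵀ ≈M Y ᵀ
    ᵀ-cong {mat _ _ _ _} {mat _ _ _ _} (p , q , r , s) = p , r , q , s

    ·-ᵀ : ∀ X Y → (X · Y) ᵀ ≈M (Y ᵀ · X ᵀ)
    ·-ᵀ (mat a b c d) (mat a′ b′ c′ d′) =
      entry a a′ b c′ , entry c a′ d c′ , entry a b′ b d′ , entry c b′ d d′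
      where
      entry : ∀ x y z w → (x ⊗ y ⊕ z ⊗ w) ≈ (y ⊗ x ⊕ w ⊗ z)
      entry x y z w = ⊕-cong (⊗-comm x y) (⊗-comm z w)

    infixl 7 _·ₚ_

    _·ₚ_ : ∀ {n} → Mat (Polynomial n) → Mat (Polynomial n) → Mat (Polynomial n)
    mat a b c d ·ₚ mat a′ b′ c′ d′ =
      mat (a :* a′ :+ b :* c′) (a :* b′ :+ b :* d′) (c :* a′ :+ d :* c′) (c :* b′ :+ d :* d′)

    ⟦_⟧M : ∀ {n} → Mat (Polynomial n) → Vec (Tm V) n → Mat (Tm V)
    ⟦ M ⟧M ρ = mapMat (λ p → ⟦ p ⟧ ρ) M

    proveM : ∀ {n} (ρ : Vec (Tm V) n) M N →
      ⟦ Mat.m11 M ⟧↓ ρ ≈ ⟦ Mat.m11 N ⟧↓ ρ → ⟦ Mat.m12 M ⟧↓ ρ ≈ ⟦ Mat.m12 N ⟧↓ ρ →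
      ⟦ Mat.m21 M ⟧↓ ρ ≈ ⟦ Mat.m21 N ⟧↓ ρ → ⟦ Mat.m22 M ⟧↓ ρ ≈ ⟦ Mat.m22 N ⟧↓ ρ → ⟦ M ⟧M ρ ≈M ⟦ N ⟧M ρ
    proveM ρ (mat a b c d) (mat a′ b′ c′ d′) p₁₁ p₁₂ p₂₁ p₂₂ =
      prove ρ a a′ p₁₁ , prove ρ b b′ p₁₂ , prove ρ c c′ p₂₁ , prove ρ d d′ p₂₂

    κ0 κ1 : ∀ {n} → Polynomial n
    κ0 = con (+ 0)
    κ1 = con (+ 1)

    Qₚ : ∀ {n} → Polynomial n → Mat (Polynomial n)
    Qₚ x = mat x κ1 κ1 κ0

    upper lower : Tm V → Mat (Tm V)
    upper x = mat (con 1#) x (con 0#) (con 1#)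
    lower x = mat (con 1#) (con 0#) x (con 1#)

    upperₚ lowerₚ : ∀ {n} → Polynomial n → Mat (Polynomial n)
    upperₚ x = mat κ1 x κ0 κ1
    lowerₚ x = mat κ1 κ0 x κ1

    diag : Tm V → Tm V → Mat (Tm V)
    diag x y = mat x (con 0#) (con 0#) y

    diagₚ : ∀ {n} → Polynomial n → Polynomial n → Mat (Polynomial n)
    diagₚ x y = mat x κ0 κ0 y

    Q-Q0 : ∀ x → (Q x · Q (con 0#)) ≈M upper x
    Q-Q0 x = proveM (x ∷ []) (Qₚ x₀ ·ₚ Qₚ κ0) (upperₚ x₀) refl′ refl′ refl′ refl′
      where
      x₀ : Polynomial 1
      x₀ = var (# 0)

    Q-Q0-Q : ∀ x y → ((Q x · Q (con 0#)) · Q y) ≈M Q (x ⊕ y)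
    Q-Q0-Q x y = proveM (x ∷ y ∷ []) (Qₚ x₀ ·ₚ Qₚ κ0 ·ₚ Qₚ y₀) (Qₚ (x₀ :+ y₀)) refl′ refl′ refl′ refl′
      where
      x₀ y₀ : Polynomial 2
      x₀ = var (# 0)
      y₀ = var (# 1)

    Q-Q-Q≈diag : ∀ p q → (p ⊗ q) ≈ con 1# → (Q p · (Q (⊖ q) · (Q p · idMat))) ≈M diag p (⊖ q)
    Q-Q-Q≈diag p q pq≈1 = begin
      Q p · (Q (⊖ q) · (Q p · idMat))
        ≈⟨ proveM (p ∷ q ∷ []) (Qₚ p₀ ·ₚ (Qₚ (:- q₀) ·ₚ (Qₚ p₀ ·ₚ diagₚ κ1 κ1))) (mat (p₀ :+ p₀ :* δₚ) δₚ δₚ (:- q₀))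
             refl′ refl′ refl′ refl′ ⟩
      mat (p ⊕ p ⊗ δ) δ δ (⊖ q)
        ≈⟨ trans′ (⊕-cong refl′ (trans′ (⊗-cong refl′ δ≈0) (zeroʳ p))) (⊕-id p) , δ≈0 , δ≈0 , refl′ ⟩
      diag p (⊖ q) ∎
      where
      open MatReasoning
      p₀ q₀ δₚ : Polynomial 2
      p₀ = var (# 0)
      q₀ = var (# 1)
      δₚ = κ1 :+ :- (p₀ :* q₀)
      δ : Tm V
      δ = con 1# ⊕ ⊖ (p ⊗ q)
      δ≈0 : δ ≈ con 0#
      δ≈0 = trans′ (⊕-cong (sym′ pq≈1) refl′) (⊕-inv _)

    diag-conjugate : ∀ p q m₁₁ m₁₂ m₂₁ m₂₂ →
      (diag p (⊖ q) · (mat m₁₁ m₁₂ m₂₁ m₂₂ · diag q (⊖ p)))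
        ≈M mat ((p ⊗ q) ⊗ m₁₁) (⊖ ((p ⊗ p) ⊗ m₁₂)) (⊖ ((q ⊗ q) ⊗ m₂₁)) ((p ⊗ q) ⊗ m₂₂)
    diag-conjugate p q m₁₁ m₁₂ m₂₁ m₂₂ = proveM (p ∷ q ∷ m₁₁ ∷ m₁₂ ∷ m₂₁ ∷ m₂₂ ∷ [])
      (diagₚ p₀ (:- q₀) ·ₚ (mat e f g h ·ₚ diagₚ q₀ (:- p₀)))
      (mat ((p₀ :* q₀) :* e) (:- ((p₀ :* p₀) :* f)) (:- ((q₀ :* q₀) :* g)) ((p₀ :* q₀) :* h))
      refl′ refl′ refl′ refl′
      where
      p₀ q₀ e f g h : Polynomial 6
      p₀ = var (# 0)
      q₀ = var (# 1)
      e = var (# 2)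
      f = var (# 3)
      g = var (# 4)
      h = var (# 5)

  ren-cong : ∀ {a b a′ b′} {V : Set a} {W : Set b} {Ax : Tm V → Tm V → Set a′} {Bx : Tm W → Tm W → Set b′}
    (f : V → W) → (∀ {s t} → Ax s t → Eq Bx (ren f s) (ren f t)) →
    ∀ {s t} → Eq Ax s t → Eq Bx (ren f s) (ren f t)
  ren-cong f h (ax x)            = h x
  ren-cong f h refl′             = refl′
  ren-cong f h (sym′ p)          = sym′ (ren-cong f h p)
  ren-cong f h (trans′ p q)      = trans′ (ren-cong f h p) (ren-cong f h q)
  ren-cong f h (⊕-cong p q)      = ⊕-cong (ren-cong f h p) (ren-cong f h q)
  ren-cong f h (⊗-cong p q)      = ⊗-cong (ren-cong f h p) (ren-cong f h q)
  ren-cong f h (⊖-cong p)        = ⊖-cong (ren-cong f h p)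
  ren-cong f h (⊕-assoc s t u)   = ⊕-assoc _ _ _
  ren-cong f h (⊕-comm s t)      = ⊕-comm _ _
  ren-cong f h (⊕-id t)          = ⊕-id _
  ren-cong f h (⊕-inv t)         = ⊕-inv _
  ren-cong f h (⊗-assoc s t u)   = ⊗-assoc _ _ _
  ren-cong f h (⊗-comm s t)      = ⊗-comm _ _
  ren-cong f h (⊗-id t)          = ⊗-id _
  ren-cong f h (⊗-distrib s t u) = ⊗-distrib _ _ _
  ren-cong f h (con-≈ x)         = con-≈ x
  ren-cong f h (con-+ x y)       = con-+ x y
  ren-cong f h (con-* x y)       = con-* x y
  ren-cong f h (con-- x)         = con-- x

  module Px = TermRing (NoAx {V = ℕ})
  module P = TermRing (NoAx {V = VEX})
  module L = TermRing AxL
  open P using (⟦_⟧M)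

  embX-cong : ∀ {s t : PX} → s ≈P t → embX s ≈P embX t
  embX-cong = ren-cong _ (λ ())

  embEX-cong : ∀ {s t : PEX} → s ≈P t → embEX s ≈L embEX t
  embEX-cong = ren-cong _ (λ ())

  mapMat-embEX-cong : ∀ {X Y : Mat PEX} → X P.≈M Y → mapMat embEX X L.≈M mapMat embEX Y
  mapMat-embEX-cong {mat _ _ _ _} {mat _ _ _ _} (p , q , r , s) = embEX-cong p , embEX-cong q , embEX-cong r , embEX-cong s

  prodQ : ∀ {n} → Vec Affine n → Mat PL
  prodQ []       = idMat
  prodQ (A ∷ As) = primQ A · prodQ As

  prodQ-++ : ∀ {m n} (As : Vec Affine m) (Bs : Vec Affine n) → prodQ (As ++ Bs) L.≈M (prodQ As · prodQ Bs)
  prodQ-++ []       Bs = L.≈M-sym (L.·-identityˡ _)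
  prodQ-++ (A ∷ As) Bs =
    L.≈M-trans (L.·-cong (L.≈M-refl {primQ A}) (prodQ-++ As Bs)) (L.≈M-sym (L.·-assoc (primQ A) (prodQ As) (prodQ Bs)))

  prodMat-lookup : ∀ {n} (As : Vec Affine n) → prodMat n (λ i → primQ (lookup As i)) ≡ prodQ As
  prodMat-lookup []       = ≡.refl
  prodMat-lookup (A ∷ As) = ≡.cong (primQ A ·_) (prodMat-lookup As)

  prodQ-∷ʳ : ∀ {n} (As : Vec Affine n) A → prodQ (As ∷ʳ A) L.≈M (prodQ As · primQ A)
  prodQ-∷ʳ []       A = L.≈M-trans (L.·-identityʳ (primQ A)) (L.≈M-sym (L.·-identityˡ (primQ A)))
  prodQ-∷ʳ (B ∷ As) A = L.≈M-trans (L.·-cong (L.≈M-refl {primQ B}) (prodQ-∷ʳ As A)) (L.≈M-sym (L.·-assoc _ _ _))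

  -- Q-matrices are symmetric, so transposing a product of them reverses the factors.
  prodQ-reverse : ∀ {n} (As : Vec Affine n) → prodQ (reverse As) L.≈M prodQ As ᵀ
  prodQ-reverse []       = L.≈M-refl
  prodQ-reverse (A ∷ As) = begin
    prodQ (reverse (A ∷ As))         ≡⟨ ≡.cong prodQ (reverse-∷ A As) ⟩
    prodQ (reverse As ∷ʳ A)          ≈⟨ prodQ-∷ʳ (reverse As) A ⟩
    prodQ (reverse As) · primQ A     ≈⟨ L.·-cong (prodQ-reverse As) (L.≈M-refl {primQ A}) ⟩
    prodQ As ᵀ · primQ A ᵀ           ≈⟨ L.·-ᵀ (primQ A) (prodQ As) ⟨
    (primQ A · prodQ As) ᵀ           ∎
    where open L.MatReasoning

  module _ where
    open P using (solve; _:=_; _:+_; _:*_; :-_) renaming (con to κ)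

    εdeg : PEX → ℕ
    εdeg (con _)      = 0
    εdeg (var ε′)     = 1
    εdeg (var (x′ _)) = 0
    εdeg (s ⊕ t)      = εdeg s ⊔ εdeg t
    εdeg (s ⊗ t)      = εdeg s + εdeg t
    εdeg (⊖ t)        = εdeg t

    εdeg-powε : ∀ j → εdeg (powε j) ≡ j
    εdeg-powε zero    = ≡.refl
    εdeg-powε (suc j) = ≡.cong suc (εdeg-powε j)

    εdeg-embX : ∀ p → εdeg (embX p) ≡ 0
    εdeg-embX (con x) = ≡.refl
    εdeg-embX (var x) = ≡.refl
    εdeg-embX (s ⊕ t) = ≡.cong₂ _⊔_ (εdeg-embX s) (εdeg-embX t)
    εdeg-embX (s ⊗ t) = ≡.cong₂ _+_ (εdeg-embX s) (εdeg-embX t)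
    εdeg-embX (⊖ t)   = εdeg-embX t

    -- Polynomials in ε over F[x], as coefficient lists read in Horner form.
    EpsPoly : Set c
    EpsPoly = List PX

    ⟦_⟧ε : EpsPoly → PEX
    ⟦ [] ⟧ε    = con 0#
    ⟦ a ∷ p ⟧ε = embX a ⊕ εEX ⊗ ⟦ p ⟧ε

    infixl 6 _+ε_
    infixl 7 _*ε_ _◃ε_

    _+ε_ : EpsPoly → EpsPoly → EpsPoly
    []      +ε q       = q
    (a ∷ p) +ε []      = a ∷ p
    (a ∷ p) +ε (b ∷ q) = (a ⊕ b) ∷ (p +ε q)

    _◃ε_ : PX → EpsPoly → EpsPoly
    a ◃ε p = map (a ⊗_) p

    _*ε_ : EpsPoly → EpsPoly → EpsPoly
    []      *ε q       = []
    (a ∷ p) *ε []      = []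
    (a ∷ p) *ε (b ∷ q) = (a ⊗ b) ∷ (a ◃ε q +ε p *ε (b ∷ q))

    -ε_ : EpsPoly → EpsPoly
    -ε_ = map ⊖_

    +ε-sound : ∀ p q → ⟦ p +ε q ⟧ε ≈P (⟦ p ⟧ε ⊕ ⟦ q ⟧ε)
    +ε-sound []      q       = sym′ (P.⊕-identityˡ _)
    +ε-sound (a ∷ p) []      = sym′ (⊕-id _)
    +ε-sound (a ∷ p) (b ∷ q) = trans′ (⊕-cong refl′ (⊗-cong refl′ (+ε-sound p q)))
      (solve 5 (λ a b e P Q → (a :+ b) :+ e :* (P :+ Q) := (a :+ e :* P) :+ (b :+ e :* Q)) refl′ (embX a) (embX b) εEX ⟦ p ⟧ε ⟦ q ⟧ε)

    ◃ε-sound : ∀ a p → ⟦ a ◃ε p ⟧ε ≈P (embX a ⊗ ⟦ p ⟧ε)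
    ◃ε-sound a []      = sym′ (P.zeroʳ _)
    ◃ε-sound a (b ∷ p) = trans′ (⊕-cong refl′ (⊗-cong refl′ (◃ε-sound a p)))
      (solve 4 (λ a b e P → (a :* b) :+ e :* (a :* P) := a :* (b :+ e :* P)) refl′ (embX a) (embX b) εEX ⟦ p ⟧ε)

    *ε-sound : ∀ p q → ⟦ p *ε q ⟧ε ≈P (⟦ p ⟧ε ⊗ ⟦ q ⟧ε)
    *ε-sound []      q       = sym′ (P.zeroˡ _)
    *ε-sound (a ∷ p) []      = sym′ (P.zeroʳ _)
    *ε-sound (a ∷ p) (b ∷ q) =
      trans′ (⊕-cong refl′ (⊗-cong refl′ (trans′ (+ε-sound _ _) (⊕-cong (◃ε-sound a q) (*ε-sound p (b ∷ q))))))
      (solve 5 (λ a b e P Q → (a :* b) :+ e :* ((a :* Q) :+ (P :* (b :+ e :* Q))) := (a :+ e :* P) :* (b :+ e :* Q))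
        refl′ (embX a) (embX b) εEX ⟦ p ⟧ε ⟦ q ⟧ε)

    -ε-sound : ∀ p → ⟦ -ε p ⟧ε ≈P (⊖ ⟦ p ⟧ε)
    -ε-sound []      = sym′ P.-0#≈0#
    -ε-sound (a ∷ p) = trans′ (⊕-cong refl′ (⊗-cong refl′ (-ε-sound p)))
      (solve 3 (λ a e P → (:- a) :+ e :* (:- P) := :- (a :+ e :* P)) refl′ (embX a) εEX ⟦ p ⟧ε)

    length-+ε : ∀ p q → length (p +ε q) ≡ length p ⊔ length q
    length-+ε []      q       = ≡.refl
    length-+ε (a ∷ p) []      = ≡.refl
    length-+ε (a ∷ p) (b ∷ q) = ≡.cong suc (length-+ε p q)

    length-*ε : ∀ p q → length (p *ε q) ≤ ℕ.pred (length p + length q)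
    length-*ε []      q       = z≤n
    length-*ε (a ∷ p) []      = z≤n
    length-*ε (a ∷ p) (b ∷ q) = begin
      suc (length (a ◃ε q +ε p *ε (b ∷ q)))           ≡⟨ ≡.cong suc (length-+ε (a ◃ε q) _) ⟩
      suc (length (a ◃ε q) ⊔ length (p *ε (b ∷ q)))   ≤⟨ s≤s (⊔-mono-≤ (≤-reflexive (length-map _ q)) (≤-trans (length-*ε p (b ∷ q))
                                                           (≤-reflexive (≡.cong ℕ.pred (+-suc (length p) (length q)))))) ⟩
      suc (length q ⊔ (length p + length q))          ≡⟨ ≡.cong suc (m≤n⇒m⊔n≡n (m≤n+m _ (length p))) ⟩
      suc (length p + length q)                       ≡⟨ +-suc (length p) (length q) ⟨
      length p + suc (length q)                       ∎
      where open ≤-Reasoning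

    toEpsPoly : PEX → EpsPoly
    toEpsPoly (con k)      = con k ∷ []
    toEpsPoly (var ε′)     = con 0# ∷ con 1# ∷ []
    toEpsPoly (var (x′ i)) = var i ∷ []
    toEpsPoly (s ⊕ t)      = toEpsPoly s +ε toEpsPoly t
    toEpsPoly (s ⊗ t)      = toEpsPoly s *ε toEpsPoly t
    toEpsPoly (⊖ t)        = -ε toEpsPoly t

    toEpsPoly-sound : ∀ t → t ≈P ⟦ toEpsPoly t ⟧ε
    toEpsPoly-sound (con k)      = sym′ (trans′ (⊕-cong refl′ (P.zeroʳ _)) (⊕-id _))
    toEpsPoly-sound (var ε′)     =
      sym′ (solve 1 (λ e → κ (+ 0) :+ e :* (κ (+ 1) :+ e :* κ (+ 0)) := e) refl′ εEX)
    toEpsPoly-sound (var (x′ i)) = sym′ (trans′ (⊕-cong refl′ (P.zeroʳ _)) (⊕-id _))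
    toEpsPoly-sound (s ⊕ t)      = trans′ (⊕-cong (toEpsPoly-sound s) (toEpsPoly-sound t)) (sym′ (+ε-sound _ _))
    toEpsPoly-sound (s ⊗ t)      = trans′ (⊗-cong (toEpsPoly-sound s) (toEpsPoly-sound t)) (sym′ (*ε-sound _ _))
    toEpsPoly-sound (⊖ t)        = trans′ (⊖-cong (toEpsPoly-sound t)) (sym′ (-ε-sound _))

    length-toEpsPoly : ∀ t → length (toEpsPoly t) ≤ suc (εdeg t)
    length-toEpsPoly (con k)      = s≤s z≤n
    length-toEpsPoly (var ε′)     = s≤s (s≤s z≤n)
    length-toEpsPoly (var (x′ i)) = s≤s z≤n
    length-toEpsPoly (s ⊕ t)      = ≤-trans (≤-reflexive (length-+ε (toEpsPoly s) (toEpsPoly t)))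
      (⊔-mono-≤ (length-toEpsPoly s) (length-toEpsPoly t))
    length-toEpsPoly (s ⊗ t)      = ≤-trans (length-*ε (toEpsPoly s) (toEpsPoly t))
      (≤-trans (pred-mono-≤ (+-mono-≤ (length-toEpsPoly s) (length-toEpsPoly t))) (≤-reflexive (+-suc (εdeg s) (εdeg t))))
    length-toEpsPoly (⊖ t)        = ≤-trans (≤-reflexive (length-map ⊖_ (toEpsPoly t))) (length-toEpsPoly t)

    coeffε : EpsPoly → ℕ → PX
    coeffε []      _       = con 0#
    coeffε (a ∷ p) zero    = a
    coeffε (a ∷ p) (suc j) = coeffε p j

    monomial : EpsPoly → ∀ {m} → Fin m → PEX
    monomial p j = powε (toℕ j) ⊗ embX (coeffε p (toℕ j))

    ⟦⟧ε-as-sum : ∀ d p → length p ≤ suc d → ⟦ p ⟧ε ≈P sumFin (suc d) (monomial p)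
    ⟦⟧ε-as-sum d       []          _       = sym′ (P.sumFin-zero (suc d) {monomial []} (λ _ → P.zeroʳ _))
    ⟦⟧ε-as-sum zero    (a ∷ [])    _       = ⊕-cong (sym′ (P.⊗-identityˡ _)) (P.zeroʳ _)
    ⟦⟧ε-as-sum zero    (a ∷ _ ∷ _) (s≤s ())
    ⟦⟧ε-as-sum (suc d) (a ∷ p)     (s≤s l) = ⊕-cong (sym′ (P.⊗-identityˡ _)) (begin
      εEX ⊗ ⟦ p ⟧ε                                     ≈⟨ ⊗-cong refl′ (⟦⟧ε-as-sum d p l) ⟩
      εEX ⊗ sumFin (suc d) (monomial p)                ≈⟨ P.sumFin-⊗ˡ εEX (suc d) {monomial p} ⟨
      sumFin (suc d) (λ j → εEX ⊗ monomial p j)        ≈⟨ P.sumFin-cong (suc d) {λ j → εEX ⊗ monomial p j} (λ j → sym′ (⊗-assoc _ _ _)) ⟩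
      sumFin (suc d) (λ j → monomial (a ∷ p) (fsuc j))  ∎)
      where open P.Reasoning

    εdeg≤⇒EpsDeg≤ : ∀ {d} t → εdeg t ≤ d → EpsDeg≤ d t
    εdeg≤⇒EpsDeg≤ {d} t le = (λ j → coeffε (toEpsPoly t) (toℕ j)) ,
      trans′ (toEpsPoly-sound t) (⟦⟧ε-as-sum d (toEpsPoly t) (≤-trans (length-toEpsPoly t) (s≤s le)))

  evalAtOne : PE → K
  evalAtOne (con k) = k
  evalAtOne (var _) = 1#
  evalAtOne (s ⊕ t) = evalAtOne s 𝔽.+ evalAtOne t
  evalAtOne (s ⊗ t) = evalAtOne s 𝔽.* evalAtOne t
  evalAtOne (⊖ t)   = 𝔽.- evalAtOne t

  evalAtOne-cong : ∀ {s t} → s ≈P t → evalAtOne s ≈𝔽 evalAtOne t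
  evalAtOne-cong (ax ())
  evalAtOne-cong refl′             = 𝔽.refl
  evalAtOne-cong (sym′ p)          = 𝔽.sym (evalAtOne-cong p)
  evalAtOne-cong (trans′ p q)      = 𝔽.trans (evalAtOne-cong p) (evalAtOne-cong q)
  evalAtOne-cong (⊕-cong p q)      = 𝔽.+-cong (evalAtOne-cong p) (evalAtOne-cong q)
  evalAtOne-cong (⊗-cong p q)      = 𝔽.*-cong (evalAtOne-cong p) (evalAtOne-cong q)
  evalAtOne-cong (⊖-cong p)        = 𝔽.-‿cong (evalAtOne-cong p)
  evalAtOne-cong (⊕-assoc s t u)   = 𝔽.+-assoc _ _ _
  evalAtOne-cong (⊕-comm s t)      = 𝔽.+-comm _ _
  evalAtOne-cong (⊕-id t)          = 𝔽.+-identityʳ _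
  evalAtOne-cong (⊕-inv t)         = 𝔽.-‿inverseʳ _
  evalAtOne-cong (⊗-assoc s t u)   = 𝔽.*-assoc _ _ _
  evalAtOne-cong (⊗-comm s t)      = 𝔽.*-comm _ _
  evalAtOne-cong (⊗-id t)          = 𝔽.*-identityʳ _
  evalAtOne-cong (⊗-distrib s t u) = 𝔽.distribˡ _ _ _
  evalAtOne-cong (con-≈ x)         = x
  evalAtOne-cong (con-+ x y)       = 𝔽.refl
  evalAtOne-cong (con-* x y)       = 𝔽.refl
  evalAtOne-cong (con-- x)         = 𝔽.refl

  powεE : ℕ → PE
  powεE zero    = con 1#
  powεE (suc j) = var tt ⊗ powεE j

  -- Evaluation at ε = 1 sends ε^j to 1 ≠ 0.
  powεE≉0 : ∀ j → ¬ (powεE j ≈P con 0#)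
  powεE≉0 j p = 𝔽.0≉1 (𝔽.trans (𝔽.sym (evalAtOne-cong p)) (evalAtOne-powεE j))
    where
    evalAtOne-powεE : ∀ j → evalAtOne (powεE j) ≈𝔽 1#
    evalAtOne-powεE zero    = 𝔽.refl
    evalAtOne-powεE (suc j) = 𝔽.trans (𝔽.*-identityˡ _) (evalAtOne-powεE j)

  embE-powεE : ∀ j → embE (powεE j) ≡ embEX (powε j)
  embE-powεE zero    = ≡.refl
  embE-powεE (suc j) = ≡.cong (var ε″ ⊗_) (embE-powεE j)

  ε^ : ℕ → PL
  ε^ j = embEX (powε j)

  ε^- : ℕ → PL
  ε^- j = var (inv (powεE j))

  ε^-inverseʳ : ∀ j → (ε^ j ⊗ ε^- j) ≈L con 1#
  ε^-inverseʳ j = trans′ (⊗-comm _ _)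
    (trans′ (⊗-cong refl′ (L.≡⇒≈ (≡.sym (embE-powεE j)))) (ax (inv-ax (powεE j) (powεE≉0 j))))

  ε^-inverseˡ : ∀ j → (ε^- j ⊗ ε^ j) ≈L con 1#
  ε^-inverseˡ j = trans′ (⊗-comm _ _) (ε^-inverseʳ j)

  polyCoef : PE → Coef
  polyCoef p = record { num = p ; den = con 1# ; den≉0 = powεE≉0 0 }

  coefL-polyCoef : ∀ p → coefL (polyCoef p) ≈L embE p
  coefL-polyCoef p = trans′ (⊗-cong refl′ (trans′ (sym′ (⊗-id _)) (ax (inv-ax (con 1#) (powεE≉0 0))))) (⊗-id _)

  invPowCoef : K → ℕ → Coef
  invPowCoef k j = record { num = con k ; den = powεE j ; den≉0 = powεE≉0 j }

  constAffine : Coef → Affine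
  constAffine r = record { const = r ; m = 0 ; coef = λ () }

  primQ-constAffine≈Q : ∀ r {x} → coefL r ≈L x → primQ (constAffine r) L.≈M Q x
  primQ-constAffine≈Q r r≈x = trans′ (⊕-id _) r≈x , refl′ , refl′ , refl′

  unitCoefs : ∀ i → Fin (suc i) → Coef
  unitCoefs zero    _        = polyCoef (con 1#)
  unitCoefs (suc i) fzero    = polyCoef (con 0#)
  unitCoefs (suc i) (fsuc j) = unitCoefs i j

  varAffine : ℕ → Affine
  varAffine i = record { const = polyCoef (con 0#) ; m = suc i ; coef = unitCoefs i }

  affineL-varAffine : ∀ i → affineL (varAffine i) ≈L var (x″ i)
  affineL-varAffine i = trans′ (⊕-cong (coefL-polyCoef _) (shifted 0 i)) (L.⊕-identityˡ _)
    where
    shifted : ∀ o i → sumFin (suc i) (λ j → coefL (unitCoefs i j) ⊗ var (x″ (o + toℕ j))) ≈L var (x″ (o + i))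
    shifted o zero    = trans′ (⊕-id _) (trans′ (⊗-cong (coefL-polyCoef _) refl′) (L.⊗-identityˡ _))
    shifted o (suc i) = trans′
      (⊕-cong (trans′ (⊗-cong (coefL-polyCoef _) refl′) (L.zeroˡ _))
              (trans′ (L.sumFin-cong (suc i) λ j → L.≡⇒≈ (≡.cong (λ z → coefL (unitCoefs i j) ⊗ var (x″ z)) (+-suc o (toℕ j))))
                      (shifted (suc o) i)))
      (trans′ (L.⊕-identityˡ _) (L.≡⇒≈ (≡.cong (λ z → var (x″ z)) (≡.sym (+-suc o i)))))

  -- Approximations of matrices by products of primitive Q-matrices

  infixl 6 _⊞_
  infixl 7 _⊡_

  _⊞_ : Mat PEX → Mat PEX → Mat PEX
  mat a b c d ⊞ mat a′ b′ c′ d′ = mat (a ⊕ a′) (b ⊕ b′) (c ⊕ c′) (d ⊕ d′)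

  _⊡_ : PEX → Mat PEX → Mat PEX
  r ⊡ mat a b c d = mat (r ⊗ a) (r ⊗ b) (r ⊗ c) (r ⊗ d)

  zeroM : Mat PEX
  zeroM = mat (con 0#) (con 0#) (con 0#) (con 0#)

  perturb : ℕ → Mat PEX → Mat PEX → Mat PEX
  perturb j X E = X ⊞ powε j ⊡ E

  ScaledDeg≤ : ℕ → ℕ → Mat PEX → Set
  ScaledDeg≤ s d = MatAll (λ x → s + εdeg x ≤ d)

  ScaledDeg≤-mono : ∀ {s d d′} X → d ≤ d′ → ScaledDeg≤ s d X → ScaledDeg≤ s d′ X
  ScaledDeg≤-mono (mat _ _ _ _) le (p , q , r , t) = ≤-trans p le , ≤-trans q le , ≤-trans r le , ≤-trans t le

  ScaledDeg≤-⊞ : ∀ {s d} X Y → ScaledDeg≤ s d X → ScaledDeg≤ s d Y → ScaledDeg≤ s d (X ⊞ Y)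
  ScaledDeg≤-⊞ {s} (mat x₁ x₂ x₃ x₄) (mat y₁ y₂ y₃ y₄) (p₁ , p₂ , p₃ , p₄) (q₁ , q₂ , q₃ , q₄) =
    entry x₁ y₁ p₁ q₁ , entry x₂ y₂ p₂ q₂ , entry x₃ y₃ p₃ q₃ , entry x₄ y₄ p₄ q₄
    where
    entry : ∀ {d} x y → s + εdeg x ≤ d → s + εdeg y ≤ d → s + εdeg (x ⊕ y) ≤ d
    entry x y p q = ≤-trans (≤-reflexive (+-distribˡ-⊔ s (εdeg x) (εdeg y))) (⊔-lub p q)

  ScaledDeg≤-· : ∀ {s t d d′} X Y → ScaledDeg≤ s d X → ScaledDeg≤ t d′ Y → ScaledDeg≤ (s + t) (d + d′) (X · Y)
  ScaledDeg≤-· {s} {t} (mat x₁ x₂ x₃ x₄) (mat y₁ y₂ y₃ y₄) (p₁ , p₂ , p₃ , p₄) (q₁ , q₂ , q₃ , q₄) =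
    entry x₁ y₁ x₂ y₃ p₁ q₁ p₂ q₃ , entry x₁ y₂ x₂ y₄ p₁ q₂ p₂ q₄ ,
    entry x₃ y₁ x₄ y₃ p₃ q₁ p₄ q₃ , entry x₃ y₂ x₄ y₄ p₃ q₂ p₄ q₄
    where
    product : ∀ {d d′} x y → s + εdeg x ≤ d → t + εdeg y ≤ d′ → (s + t) + εdeg (x ⊗ y) ≤ d + d′
    product x y p q = ≤-trans (≤-reflexive (interchange s t (εdeg x) (εdeg y))) (+-mono-≤ p q)
    entry : ∀ {d d′} a b a′ b′ → s + εdeg a ≤ d → t + εdeg b ≤ d′ → s + εdeg a′ ≤ d → t + εdeg b′ ≤ d′ →
            (s + t) + εdeg (a ⊗ b ⊕ a′ ⊗ b′) ≤ d + d′
    entry a b a′ b′ p q p′ q′ = ≤-trans (≤-reflexive (+-distribˡ-⊔ (s + t) (εdeg (a ⊗ b)) (εdeg (a′ ⊗ b′))))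
      (⊔-lub (product a b p q) (product a′ b′ p′ q′))

  ScaledDeg≤-⊡ : ∀ {s d} i X → ScaledDeg≤ (i + s) d X → ScaledDeg≤ s d (powε i ⊡ X)
  ScaledDeg≤-⊡ {s} i (mat x₁ x₂ x₃ x₄) (p₁ , p₂ , p₃ , p₄) = entry x₁ p₁ , entry x₂ p₂ , entry x₃ p₃ , entry x₄ p₄
    where
    entry : ∀ {d} x → (i + s) + εdeg x ≤ d → s + εdeg (powε i ⊗ x) ≤ d
    entry x = ≤-trans (≤-reflexive (begin
      s + (εdeg (powε i) + εdeg x)  ≡⟨ ≡.cong (λ n → s + (n + εdeg x)) (εdeg-powε i) ⟩
      s + (i + εdeg x)              ≡⟨ +-assoc s i (εdeg x) ⟨
      (s + i) + εdeg x              ≡⟨ ≡.cong (_+ εdeg x) (+-comm s i) ⟩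
      (i + s) + εdeg x              ∎))
      where open ≡.≡-Reasoning

  ScaledDeg≤-zeroM : ∀ {s d} → s ≤ d → ScaledDeg≤ s d zeroM
  ScaledDeg≤-zeroM {s} {d} le = bound , bound , bound , bound
    where
    bound : s + 0 ≤ d
    bound = ≤-trans (≤-reflexive (+-identityʳ s)) le

  ScaledDeg≤⇒≤ : ∀ {s d} X → ScaledDeg≤ s d X → s ≤ d
  ScaledDeg≤⇒≤ {s} (mat x _ _ _) (p , _) = ≤-trans (m≤m+n s (εdeg x)) p

  perturb-· : ∀ j X E Y F →
    (perturb j X E · perturb j Y F) P.≈M perturb j (X · Y) (E · Y ⊞ X · F ⊞ powε j ⊡ (E · F))
  perturb-· j (mat x₁ x₂ x₃ x₄) (mat e₁ e₂ e₃ e₄) (mat y₁ y₂ y₃ y₄) (mat f₁ f₂ f₃ f₄) =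
    entry x₁ x₂ y₁ y₃ e₁ e₂ f₁ f₃ , entry x₁ x₂ y₂ y₄ e₁ e₂ f₂ f₄ ,
    entry x₃ x₄ y₁ y₃ e₃ e₄ f₁ f₃ , entry x₃ x₄ y₂ y₄ e₃ e₄ f₂ f₄
    where
    open P using (solve; _:=_; _:+_; _:*_)
    entry : ∀ a b c d e f g h → ((a ⊕ powε j ⊗ e) ⊗ (c ⊕ powε j ⊗ g) ⊕ (b ⊕ powε j ⊗ f) ⊗ (d ⊕ powε j ⊗ h))
      ≈P ((a ⊗ c ⊕ b ⊗ d) ⊕ powε j ⊗ (((e ⊗ c ⊕ f ⊗ d) ⊕ (a ⊗ g ⊕ b ⊗ h)) ⊕ powε j ⊗ (e ⊗ g ⊕ f ⊗ h)))
    entry a b c d e f g h = solve 9 (λ a b c d e f g h r →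
      (a :+ r :* e) :* (c :+ r :* g) :+ (b :+ r :* f) :* (d :+ r :* h)
        := (a :* c :+ b :* d) :+ r :* (((e :* c :+ f :* d) :+ (a :* g :+ b :* h)) :+ r :* (e :* g :+ f :* h)))
      refl′ a b c d e f g h (powε j)

  perturb-⊞ : ∀ j {X} Y G E → X P.≈M perturb j Y G → perturb j X E P.≈M perturb j Y (G ⊞ E)
  perturb-⊞ j {mat _ _ _ _} (mat y₁ y₂ y₃ y₄) (mat g₁ g₂ g₃ g₄) (mat e₁ e₂ e₃ e₄) (p₁ , p₂ , p₃ , p₄) =
    entry y₁ g₁ e₁ p₁ , entry y₂ g₂ e₂ p₂ , entry y₃ g₃ e₃ p₃ , entry y₄ g₄ e₄ p₄
    where
    open P using (solve; _:=_; _:+_; _:*_)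
    entry : ∀ {x} y g e → x ≈P (y ⊕ powε j ⊗ g) → (x ⊕ powε j ⊗ e) ≈P (y ⊕ powε j ⊗ (g ⊕ e))
    entry y g e p = trans′ (⊕-cong p refl′)
      (solve 4 (λ y g e r → (y :+ r :* g) :+ r :* e := y :+ r :* (g :+ e)) refl′ y g e (powε j))

  perturb-zeroM : ∀ j X → X P.≈M perturb j X zeroM
  perturb-zeroM j (mat x₁ x₂ x₃ x₄) = entry x₁ , entry x₂ , entry x₃ , entry x₄
    where
    entry : ∀ x → x ≈P (x ⊕ powε j ⊗ con 0#)
    entry x = sym′ (trans′ (⊕-cong refl′ (P.zeroʳ _)) (⊕-id x))

  record Approx (j d n : ℕ) (X : Mat PEX) : Set (c ⊔ˡ ℓ) where
    constructor approx
    field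
      {count}  : ℕ
      factors  : Vec Affine count
      count≤n  : count ≤ n
      error    : Mat PEX
      product≈ : prodQ factors L.≈M mapMat embEX (perturb j X error)
      mainDeg  : ScaledDeg≤ 0 d X
      errorDeg : ScaledDeg≤ j d error

  open Approx public

  exact : ∀ {j d n X} (As : Vec Affine n) → prodQ As L.≈M mapMat embEX X → ScaledDeg≤ 0 d X → j ≤ d → Approx j d n X
  exact {j} {X = X} As eq deg j≤d =
    approx As ≤-refl zeroM (L.≈M-trans eq (mapMat-embEX-cong (perturb-zeroM j X))) deg (ScaledDeg≤-zeroM j≤d)

  infixl 7 _·ᴬ_

  _·ᴬ_ : ∀ {j d d′ n n′ X Y} → Approx j d n X → Approx j d′ n′ Y → Approx j (d + d′) (n + n′) (X · Y)
  _·ᴬ_ {j} {X = X} {Y} (approx As m≤n E eqX degX degE) (approx Bs m≤n′ F eqY degY degF) =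
    approx (As ++ Bs) (+-mono-≤ m≤n m≤n′) (E · Y ⊞ X · F ⊞ powε j ⊡ (E · F))
      (L.≈M-trans (prodQ-++ As Bs) (L.≈M-trans (L.·-cong eqX eqY) (mapMat-embEX-cong (perturb-· j X E Y F))))
      (ScaledDeg≤-· X Y degX degY)
      (ScaledDeg≤-⊞ (E · Y ⊞ X · F) (powε j ⊡ (E · F))
        (ScaledDeg≤-⊞ (E · Y) (X · F) (≡.subst (λ s → ScaledDeg≤ s _ (E · Y)) (+-identityʳ j) (ScaledDeg≤-· E Y degE degY))
                                      (ScaledDeg≤-· X F degX degF))
        (ScaledDeg≤-⊡ j (E · F) (ScaledDeg≤-· E F degE degF)))

  weaken : ∀ {j d d′ n n′ X} → d ≤ d′ → n ≤ n′ → Approx j d n X → Approx j d′ n′ X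
  weaken {X = X} d≤d′ n≤n′ (approx As m≤n E eq degX degE) =
    approx As (≤-trans m≤n n≤n′) E eq (ScaledDeg≤-mono X d≤d′ degX) (ScaledDeg≤-mono E d≤d′ degE)

  adjust : ∀ {j d n X} Y G → X P.≈M perturb j Y G → ScaledDeg≤ 0 d Y → ScaledDeg≤ j d G → Approx j d n X → Approx j d n Y
  adjust {j} Y G X≈Y+G degY degG (approx As m≤n E eq _ degE) =
    approx As m≤n (G ⊞ E) (L.≈M-trans eq (mapMat-embEX-cong (perturb-⊞ j Y G E X≈Y+G))) degY (ScaledDeg≤-⊞ G E degG degE)

  replace : ∀ {j d n X} Y → X P.≈M Y → ScaledDeg≤ 0 d Y → Approx j d n X → Approx j d n Y
  replace {j} Y X≈Y degY A =
    adjust Y zeroM (P.≈M-trans X≈Y (perturb-zeroM j Y)) degY (ScaledDeg≤-zeroM (ScaledDeg≤⇒≤ (error A) (errorDeg A))) A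

  εdeg-perturb : ∀ {j d} X E → ScaledDeg≤ 0 d X → ScaledDeg≤ j d E → MatAll (λ x → εdeg x ≤ d) (perturb j X E)
  εdeg-perturb {j} (mat x₁ x₂ x₃ x₄) (mat e₁ e₂ e₃ e₄) (p₁ , p₂ , p₃ , p₄) (q₁ , q₂ , q₃ , q₄) =
    entry x₁ e₁ p₁ q₁ , entry x₂ e₂ p₂ q₂ , entry x₃ e₃ p₃ q₃ , entry x₄ e₄ p₄ q₄
    where
    entry : ∀ {d} x e → εdeg x ≤ d → j + εdeg e ≤ d → εdeg (x ⊕ powε j ⊗ e) ≤ d
    entry x e p q = ⊔-lub p (≤-trans (≤-reflexive (≡.cong (_+ εdeg e) (εdeg-powε j))) q)

  transposeᴬ : ∀ {j d n X} → Approx j d n X → Approx j d n (X ᵀ)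
  transposeᴬ (approx As m≤n E eq (p₁ , p₂ , p₃ , p₄) (q₁ , q₂ , q₃ , q₄)) =
    approx (reverse As) m≤n (E ᵀ) (L.≈M-trans (prodQ-reverse As) (L.ᵀ-cong eq)) (p₁ , p₃ , p₂ , p₄) (q₁ , q₃ , q₂ , q₄)

  powε-+ : ∀ m n → powε (m + n) ≈P (powε m ⊗ powε n)
  powε-+ zero    n = sym′ (P.⊗-identityˡ _)
  powε-+ (suc m) n = trans′ (⊗-cong refl′ (powε-+ m n)) (sym′ (⊗-assoc _ _ _))

  -- diag(ε^i, -ε^-i) and diag(ε^-i, -ε^i), each a product of three primitive Q-matrices
  diagUp diagDown : ℕ → Vec Affine 3
  diagUp   i = constAffine (polyCoef (powεE i)) ∷ constAffine (invPowCoef (𝔽.-_ 1#) i) ∷ constAffine (polyCoef (powεE i)) ∷ []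
  diagDown i = constAffine (invPowCoef 1# i) ∷ constAffine (polyCoef (⊖ powεE i)) ∷ constAffine (invPowCoef 1# i) ∷ []

  private
    prodQ-constAffine³ : ∀ r s p q → coefL r ≈L p → coefL s ≈L (⊖ q) → (p ⊗ q) ≈L con 1# →
      prodQ (constAffine r ∷ constAffine s ∷ constAffine r ∷ []) L.≈M L.diag p (⊖ q)
    prodQ-constAffine³ r s p q r≈p s≈-q pq≈1 = L.≈M-trans
      (L.·-cong Qr≈Qp (L.·-cong (primQ-constAffine≈Q s s≈-q) (L.·-cong Qr≈Qp (L.≈M-refl {idMat}))))
      (L.Q-Q-Q≈diag p q pq≈1)
      where
      Qr≈Qp : primQ (constAffine r) L.≈M Q p
      Qr≈Qp = primQ-constAffine≈Q r r≈p

  prodQ-diagUp : ∀ i → prodQ (diagUp i) L.≈M L.diag (ε^ i) (⊖ ε^- i)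
  prodQ-diagUp i = prodQ-constAffine³ (polyCoef (powεE i)) (invPowCoef (𝔽.-_ 1#) i) (ε^ i) (ε^- i)
    (trans′ (coefL-polyCoef _) (L.≡⇒≈ (embE-powεE i)))
    (trans′ (⊗-cong (con-- 1#) refl′) (trans′ (sym′ (L.-‿distribˡ-* _ _)) (⊖-cong (L.⊗-identityˡ _))))
    (ε^-inverseʳ i)

  prodQ-diagDown : ∀ i → prodQ (diagDown i) L.≈M L.diag (ε^- i) (⊖ ε^ i)
  prodQ-diagDown i = prodQ-constAffine³ (invPowCoef 1# i) (polyCoef (⊖ powεE i)) (ε^- i) (ε^ i)
    (L.⊗-identityˡ _)
    (trans′ (coefL-polyCoef _) (⊖-cong (L.≡⇒≈ (embE-powεE i))))
    (ε^-inverseˡ i)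

  module _ (i j : ℕ) where
    private
      ε²ⁱ : PEX
      ε²ⁱ = powε i ⊗ powε i

      εdeg-ε²ⁱ : εdeg ε²ⁱ ≡ i + i
      εdeg-ε²ⁱ = ≡.cong₂ _+_ (εdeg-powε i) (εdeg-powε i)

      ρ≈ε²ⁱεʲ : powε (i + i + j) ≈P (ε²ⁱ ⊗ powε j)
      ρ≈ε²ⁱεʲ = trans′ (powε-+ (i + i) j) (⊗-cong (powε-+ i i) refl′)

      cancel-ε^² : ∀ Z → ((ε^- i ⊗ ε^- i) ⊗ ((ε^ i ⊗ ε^ i) ⊗ Z)) ≈L Z
      cancel-ε^² Z = trans′ (solve 3 (λ u η Z → (η :* η) :* ((u :* u) :* Z) := (u :* η) :* ((u :* η) :* Z)) refl′ (ε^ i) (ε^- i) Z)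
        (trans′ (⊗-cong (ε^-inverseʳ i) (trans′ (⊗-cong (ε^-inverseʳ i) refl′) (L.⊗-identityˡ _))) (L.⊗-identityˡ _))
        where open L using (solve; _:=_; _:*_)

      open P using (solve; _:=_; _:+_; _:*_; :-_)

      diagonal-entry : ∀ x e → ((ε^ i ⊗ ε^- i) ⊗ embEX (x ⊕ powε (i + i + j) ⊗ e)) ≈L embEX (x ⊕ powε j ⊗ (ε²ⁱ ⊗ e))
      diagonal-entry x e = trans′ (⊗-cong (ε^-inverseʳ i) refl′) (trans′ (L.⊗-identityˡ _)
        (embEX-cong (trans′ (⊕-cong refl′ (⊗-cong ρ≈ε²ⁱεʲ refl′))
          (solve 4 (λ x e t r → x :+ (t :* r) :* e := x :+ r :* (t :* e)) refl′ x e ε²ⁱ (powε j)))))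

      scaled-entry : ∀ x e → (⊖ (ε²ⁱ ⊗ (x ⊕ powε (i + i + j) ⊗ e))) ≈P (⊖ (ε²ⁱ ⊗ x) ⊕ powε j ⊗ (⊖ (ε²ⁱ ⊗ (ε²ⁱ ⊗ e))))
      scaled-entry x e = trans′ (⊖-cong (⊗-cong refl′ (⊕-cong refl′ (⊗-cong ρ≈ε²ⁱεʲ refl′))))
        (solve 4 (λ x e t r → :- (t :* (x :+ (t :* r) :* e)) := (:- (t :* x)) :+ r :* (:- (t :* (t :* e)))) refl′ x e ε²ⁱ (powε j))

      divided-entry : ∀ x y e → x ≈P (ε²ⁱ ⊗ y) →
        (⊖ ((ε^- i ⊗ ε^- i) ⊗ embEX (x ⊕ powε (i + i + j) ⊗ e))) ≈L embEX (⊖ y ⊕ powε j ⊗ (⊖ e))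
      divided-entry x y e x≈Ty = begin
        ⊖ ((η ⊗ η) ⊗ embEX (x ⊕ powε (i + i + j) ⊗ e))   ≈⟨ ⊖-cong (⊗-cong refl′ (embEX-cong x+ρe≈ε²ⁱ[y+εʲe])) ⟩
        ⊖ ((η ⊗ η) ⊗ ((u ⊗ u) ⊗ Z))                       ≈⟨ ⊖-cong (cancel-ε^² Z) ⟩
        ⊖ Z                                               ≈⟨ embEX-cong (solve 3 (λ y e r → :- (y :+ r :* e) := (:- y) :+ r :* (:- e)) refl′ y e (powε j)) ⟩
        embEX (⊖ y ⊕ powε j ⊗ (⊖ e))                      ∎
        where
        open L.Reasoning
        u η Z : PL
        u = ε^ i
        η = ε^- i
        Z = embEX (y ⊕ powε j ⊗ e)
        x+ρe≈ε²ⁱ[y+εʲe] : (x ⊕ powε (i + i + j) ⊗ e) ≈P (ε²ⁱ ⊗ (y ⊕ powε j ⊗ e))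
        x+ρe≈ε²ⁱ[y+εʲe] = trans′ (⊕-cong x≈Ty (⊗-cong ρ≈ε²ⁱεʲ refl′))
          (solve 4 (λ y e t r → t :* y :+ (t :* r) :* e := t :* (y :+ r :* e)) refl′ y e ε²ⁱ (powε j))

      main-shift : ∀ {d} x → εdeg x ≤ d → εdeg x ≤ d + (i + i)
      main-shift x p = ≤-trans p (m≤m+n _ (i + i))

      main-scaled : ∀ {d} x → εdeg x ≤ d → εdeg (⊖ (ε²ⁱ ⊗ x)) ≤ d + (i + i)
      main-scaled {d} x p = begin
        εdeg ε²ⁱ + εdeg x   ≡⟨ ≡.cong (_+ εdeg x) εdeg-ε²ⁱ ⟩
        (i + i) + εdeg x  ≡⟨ +-comm (i + i) (εdeg x) ⟩
        εdeg x + (i + i)  ≤⟨ +-monoˡ-≤ (i + i) p ⟩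
        d + (i + i)       ∎
        where open ≤-Reasoning

      error-diagonal : ∀ {d} e → (i + i + j) + εdeg e ≤ d → j + εdeg (ε²ⁱ ⊗ e) ≤ d + (i + i)
      error-diagonal {d} e p = begin
        j + (εdeg ε²ⁱ + εdeg e)  ≡⟨ ≡.cong (λ n → j + (n + εdeg e)) εdeg-ε²ⁱ ⟩
        j + ((i + i) + εdeg e) ≡⟨ +-assoc j (i + i) (εdeg e) ⟨
        (j + (i + i)) + εdeg e ≡⟨ ≡.cong (_+ εdeg e) (+-comm j (i + i)) ⟩
        (i + i + j) + εdeg e   ≤⟨ p ⟩
        d                      ≤⟨ m≤m+n d (i + i) ⟩
        d + (i + i)            ∎
        where open ≤-Reasoning

      error-scaled : ∀ {d} e → (i + i + j) + εdeg e ≤ d → j + εdeg (⊖ (ε²ⁱ ⊗ (ε²ⁱ ⊗ e))) ≤ d + (i + i)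
      error-scaled {d} e p = begin
        j + (εdeg ε²ⁱ + (εdeg ε²ⁱ + εdeg e))  ≡⟨ ≡.cong (λ n → j + (n + (n + εdeg e))) εdeg-ε²ⁱ ⟩
        j + ((i + i) + ((i + i) + εdeg e)) ≡⟨ rearrange (i + i) j (εdeg e) ⟩
        ((i + i + j) + εdeg e) + (i + i)   ≤⟨ +-monoˡ-≤ (i + i) p ⟩
        d + (i + i)                        ∎
        where
        open ≤-Reasoning
        rearrange : ∀ a j e → j + (a + (a + e)) ≡ ((a + j) + e) + a
        rearrange = ℕ-Solver.solve-∀

      error-divided : ∀ {d} e → (i + i + j) + εdeg e ≤ d → j + εdeg (⊖ e) ≤ d + (i + i)
      error-divided {d} e p = ≤-trans (+-monoˡ-≤ (εdeg e) (m≤n+m j (i + i))) (≤-trans p (m≤m+n d (i + i)))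

    -- Conjugating by diag(ε^i, -ε^-i) multiplies the (1,2) entry by -ε^2i and divides the (2,1) entry by -ε^2i,
    -- so an error of level 2i + j is left with level j.
    conjugateUp : ∀ {d n x₁₁ x₁₂ x₂₁ x₂₂} y → x₂₁ ≈P ((powε i ⊗ powε i) ⊗ y) → εdeg y ≤ d + (i + i) →
      Approx (i + i + j) d n (mat x₁₁ x₁₂ x₂₁ x₂₂) →
      Approx j (d + (i + i)) (6 + n) (mat x₁₁ (⊖ ((powε i ⊗ powε i) ⊗ x₁₂)) (⊖ y) x₂₂)
    conjugateUp {x₁₁ = x₁₁} {x₁₂} {x₂₁} {x₂₂} y x₂₁≈Ty degy
      (approx {m} As m≤n (mat e₁₁ e₁₂ e₂₁ e₂₂) eq (p₁₁ , p₁₂ , _ , p₂₂) (q₁₁ , q₁₂ , q₂₁ , q₂₂)) =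
      approx (diagUp i ++ (As ++ diagDown i)) (+-monoʳ-≤ 3 (≤-trans (≤-reflexive (+-comm m 3)) (+-monoʳ-≤ 3 m≤n)))
        (mat (ε²ⁱ ⊗ e₁₁) (⊖ (ε²ⁱ ⊗ (ε²ⁱ ⊗ e₁₂))) (⊖ e₂₁) (ε²ⁱ ⊗ e₂₂))
        conjugated≈
        (main-shift x₁₁ p₁₁ , main-scaled x₁₂ p₁₂ , degy , main-shift x₂₂ p₂₂)
        (error-diagonal e₁₁ q₁₁ , error-scaled e₁₂ q₁₂ , error-divided e₂₁ q₂₁ , error-diagonal e₂₂ q₂₂)
      where
      open L.MatReasoning
      X+ρE : Mat PEX
      X+ρE = perturb (i + i + j) (mat x₁₁ x₁₂ x₂₁ x₂₂) (mat e₁₁ e₁₂ e₂₁ e₂₂)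
      conjugated≈ : prodQ (diagUp i ++ (As ++ diagDown i)) L.≈M
        mapMat embEX (perturb j (mat x₁₁ (⊖ (ε²ⁱ ⊗ x₁₂)) (⊖ y) x₂₂) (mat (ε²ⁱ ⊗ e₁₁) (⊖ (ε²ⁱ ⊗ (ε²ⁱ ⊗ e₁₂))) (⊖ e₂₁) (ε²ⁱ ⊗ e₂₂)))
      conjugated≈ = begin
        prodQ (diagUp i ++ (As ++ diagDown i))
          ≈⟨ L.≈M-trans (prodQ-++ (diagUp i) (As ++ diagDown i)) (L.·-cong (L.≈M-refl {prodQ (diagUp i)}) (prodQ-++ As (diagDown i))) ⟩
        prodQ (diagUp i) · (prodQ As · prodQ (diagDown i))
          ≈⟨ L.·-cong (prodQ-diagUp i) (L.·-cong eq (prodQ-diagDown i)) ⟩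
        L.diag (ε^ i) (⊖ ε^- i) · (mapMat embEX X+ρE · L.diag (ε^- i) (⊖ ε^ i))
          ≈⟨ L.diag-conjugate (ε^ i) (ε^- i) _ _ _ _ ⟩
        _ ≈⟨ diagonal-entry x₁₁ e₁₁ , embEX-cong (scaled-entry x₁₂ e₁₂) , divided-entry x₂₁ y e₂₁ x₂₁≈Ty , diagonal-entry x₂₂ e₂₂ ⟩
        mapMat embEX (perturb j (mat x₁₁ (⊖ (ε²ⁱ ⊗ x₁₂)) (⊖ y) x₂₂) (mat (ε²ⁱ ⊗ e₁₁) (⊖ (ε²ⁱ ⊗ (ε²ⁱ ⊗ e₁₂))) (⊖ e₂₁) (ε²ⁱ ⊗ e₂₂))) ∎

    conjugateDown : ∀ {d n x₁₁ x₁₂ x₂₁ x₂₂} y → x₁₂ ≈P ((powε i ⊗ powε i) ⊗ y) → εdeg y ≤ d + (i + i) →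
      Approx (i + i + j) d n (mat x₁₁ x₁₂ x₂₁ x₂₂) →
      Approx j (d + (i + i)) (6 + n) (mat x₁₁ (⊖ y) (⊖ ((powε i ⊗ powε i) ⊗ x₂₁)) x₂₂)
    conjugateDown y x₁₂≈Ty degy A = transposeᴬ (conjugateUp y x₁₂≈Ty degy (transposeᴬ A))

  module _ where
    open P using (Polynomial; ⟦_⟧; op; con; var; _:^_; :-_; fromℤ)

    εdeg-fromℤ : ∀ z → εdeg (fromℤ z) ≡ 0
    εdeg-fromℤ (+ z)    = εdeg-× z
      where
      εdeg-× : ∀ n → εdeg (fromℤ (+ n)) ≡ 0
      εdeg-× zero          = ≡.refl
      εdeg-× (suc zero)    = ≡.refl
      εdeg-× (suc (suc n)) = ≡.cong (_⊔ 0) (εdeg-× (suc n))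
    εdeg-fromℤ -[1+ z ] = εdeg-fromℤ (+ suc z)

    tdeg : ∀ {n} → (Fin n → ℕ) → Polynomial n → ℕ
    tdeg w (op [+] p q) = tdeg w p ⊔ tdeg w q
    tdeg w (op [*] p q) = tdeg w p + tdeg w q
    tdeg w (con _)      = 0
    tdeg w (var i)      = w i
    tdeg w (p :^ m)     = m * tdeg w p
    tdeg w (:- p)       = tdeg w p

    εdeg-⟦⟧ : ∀ {n} (w : Fin n → ℕ) k (ρ : Vec PEX n) → (∀ i → εdeg (lookup ρ i) ≤ w i * k) →
      ∀ p → εdeg (⟦ p ⟧ ρ) ≤ tdeg w p * k
    εdeg-⟦⟧ w k ρ hρ (op [+] p q) = ≤-trans (⊔-mono-≤ (εdeg-⟦⟧ w k ρ hρ p) (εdeg-⟦⟧ w k ρ hρ q))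
      (≤-reflexive (≡.sym (*-distribʳ-⊔ k (tdeg w p) (tdeg w q))))
    εdeg-⟦⟧ w k ρ hρ (op [*] p q) = ≤-trans (+-mono-≤ (εdeg-⟦⟧ w k ρ hρ p) (εdeg-⟦⟧ w k ρ hρ q))
      (≤-reflexive (≡.sym (*-distribʳ-+ k (tdeg w p) (tdeg w q))))
    εdeg-⟦⟧ w k ρ hρ (con z)      = ≤-reflexive (εdeg-fromℤ z)
    εdeg-⟦⟧ w k ρ hρ (var i)      = hρ i
    εdeg-⟦⟧ w k ρ hρ (p :^ m)     = ≤-trans (εdeg-^ m) (≤-reflexive (≡.sym (*-assoc m (tdeg w p) k)))
      where
      εdeg-^ : ∀ m → εdeg (⟦ p :^ m ⟧ ρ) ≤ m * (tdeg w p * k)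
      εdeg-^ zero    = z≤n
      εdeg-^ (suc m) = +-mono-≤ (εdeg-⟦⟧ w k ρ hρ p) (εdeg-^ m)
    εdeg-⟦⟧ w k ρ hρ (:- p)       = εdeg-⟦⟧ w k ρ hρ p

    tdegM : ∀ {n} → (Fin n → ℕ) → Mat (Polynomial n) → ℕ
    tdegM w (mat a b c d) = tdeg w a ⊔ tdeg w b ⊔ tdeg w c ⊔ tdeg w d

    ScaledDeg≤-⟦⟧M : ∀ {n} (w : Fin n → ℕ) k (ρ : Vec PEX n) → (∀ i → εdeg (lookup ρ i) ≤ w i * k) →
      ∀ M → ScaledDeg≤ 0 (tdegM w M * k) (⟦ M ⟧M ρ)
    ScaledDeg≤-⟦⟧M w k ρ hρ (mat a b c d) =
      bound a (≤-trans (m≤m⊔n A B) (≤-trans (m≤m⊔n (A ⊔ B) C) (m≤m⊔n (A ⊔ B ⊔ C) D))) ,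
      bound b (≤-trans (m≤n⊔m A B) (≤-trans (m≤m⊔n (A ⊔ B) C) (m≤m⊔n (A ⊔ B ⊔ C) D))) ,
      bound c (≤-trans (m≤n⊔m (A ⊔ B) C) (m≤m⊔n (A ⊔ B ⊔ C) D)) ,
      bound d (m≤n⊔m (A ⊔ B ⊔ C) D)
      where
      A B C D : ℕ
      A = tdeg w a
      B = tdeg w b
      C = tdeg w c
      D = tdeg w d
      bound : ∀ p → tdeg w p ≤ tdegM w (mat a b c d) → εdeg (⟦ p ⟧ ρ) ≤ tdegM w (mat a b c d) * k
      bound p le = ≤-trans (εdeg-⟦⟧ w k ρ hρ p) (*-monoˡ-≤ k le)

  -- The multiplication gadget

  exactQ : ∀ {j d} (A : Affine) x → affineL A ≈L embEX x → εdeg x ≤ d → j ≤ d → Approx j d 1 (Q x)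
  exactQ A x ℓ≈x degx j≤d =
    exact (A ∷ []) (L.≈M-trans (L.·-identityʳ (primQ A)) (ℓ≈x , refl′ , refl′ , refl′)) (degx , z≤n , z≤n , z≤n) j≤d

  exactQ0 : ∀ j → Approx j j 1 (Q (con 0#))
  exactQ0 j = exactQ (constAffine (polyCoef (con 0#))) (con 0#) (trans′ (⊕-id _) (coefL-polyCoef _)) z≤n ≤-refl

  exactUpper : ∀ {j d} r x → coefL r ≈L embEX x → εdeg x ≤ d → j ≤ d → Approx j d 2 (P.upper x)
  exactUpper r x r≈x degx j≤d = exact (constAffine r ∷ constAffine (polyCoef (con 0#)) ∷ [])
    (L.≈M-trans (L.·-cong (primQ-constAffine≈Q r r≈x) (L.·-identityʳ _))
      (L.≈M-trans (L.·-cong (L.≈M-refl {Q (embEX x)}) (primQ-constAffine≈Q (polyCoef (con 0#)) (coefL-polyCoef _)))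
        (L.Q-Q0 (embEX x))))
    (z≤n , degx , z≤n , z≤n) j≤d

  -- conjugateUp k lowers the level by 2k and conjugateDown (k + k) by 4k
  middleLevel inputLevel : ℕ → ℕ
  middleLevel k = (k + k) + (k + k) + (k + k)
  inputLevel  k = k + k + middleLevel k

  upperStep : ∀ {k d n} x → εdeg x ≡ 0 → Approx (inputLevel k) d n (Q x) →
    Approx (middleLevel k) (d + 10 * k) (7 + n) (P.upper (⊖ ((powε k ⊗ powε k) ⊗ x)))
  upperStep {k} {d} {n} x εdeg-x A = weaken (≤-reflexive (level-arith d k)) (≤-reflexive (count-arith n))
    (replace (P.upper (⊖ ((powε k ⊗ powε k) ⊗ x))) (refl′ , refl′ , P.-0#≈0# , refl′) (z≤n , corner , z≤n , z≤n) conjugated)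
    where
    unipotent : Approx (inputLevel k) (d + inputLevel k) (n + 1) (P.upper x)
    unipotent = replace (P.upper x) (P.Q-Q0 x) (z≤n , ≤-trans (≤-reflexive εdeg-x) z≤n , z≤n , z≤n) (A ·ᴬ exactQ0 _)
    conjugated : Approx (middleLevel k) (d + inputLevel k + (k + k)) (6 + (n + 1))
                   (mat (con 1#) (⊖ ((powε k ⊗ powε k) ⊗ x)) (⊖ con 0#) (con 1#))
    conjugated = conjugateUp k (middleLevel k) (con 0#) (sym′ (P.zeroʳ _)) z≤n unipotent
    corner : εdeg (⊖ ((powε k ⊗ powε k) ⊗ x)) ≤ d + inputLevel k + (k + k)
    corner = let (_ , p , _ , _) = mainDeg conjugated in p
    level-arith : ∀ d k → d + (k + k + ((k + k) + (k + k) + (k + k))) + (k + k) ≡ d + 10 * k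
    level-arith = ℕ-Solver.solve-∀
    count-arith : ∀ n → 6 + (n + 1) ≡ 7 + n
    count-arith = ℕ-Solver.solve-∀

  -- conjugateUp 0 conjugates by diag(1, -1)
  negateUpper : ∀ {j d n a} → Approx j d n (P.upper a) → Approx j d (6 + n) (P.upper (⊖ a))
  negateUpper {j} {d} {n} {a} A = weaken (≤-reflexive (+-identityʳ d)) ≤-refl
    (replace (P.upper (⊖ a)) (refl′ , ⊖-cong (trans′ (⊗-cong (P.⊗-identityˡ _) refl′) (P.⊗-identityˡ a)) , P.-0#≈0# , refl′)
      (z≤n , corner , z≤n , z≤n) conjugated)
    where
    conjugated : Approx j (d + 0) (6 + n) (mat (con 1#) (⊖ ((con 1# ⊗ con 1#) ⊗ a)) (⊖ con 0#) (con 1#))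
    conjugated = conjugateUp 0 j (con 0#) (sym′ (P.zeroʳ _)) z≤n A
    corner : εdeg (⊖ a) ≤ d + 0
    corner = let (_ , p , _ , _) = mainDeg A in ≤-trans p (m≤m+n d 0)

  module Templates where
    open P using (Polynomial; _:+_; _:*_; :-_; κ0; κ1) renaming (con to κ)

    κ2 κ3 : ∀ {n} → Polynomial n
    κ2 = κ (+ 2)
    κ3 = κ (+ 3)

    -- [U(a), L(b)] and [L(b), U(a)] for U, L the unipotent upper and lower matrices
    Comm Comm′ : ∀ {n} → Polynomial n → Polynomial n → Mat (Polynomial n)
    Comm a b = mat ((κ1 :+ a :* b) :+ a :* a :* b :* b) (:- (a :* a :* b)) (a :* b :* b) (κ1 :+ :- (a :* b))
    Comm′ a b = mat (κ1 :+ :- (a :* b)) (a :* a :* b) (:- (a :* b :* b)) ((a :* a :* b :* b :+ a :* b) :+ κ1)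

    W : ∀ {n} → Polynomial n → Polynomial n → Polynomial n → Polynomial n
    W a b s = b :* s :* s :+ a :* b :* b :* s :* s :+ a :* a :* b :* b :* b :* s :* s :+ κ3 :* a :* b :* s :+ κ2 :* s
      :+ κ2 :* a :* a :* b :* b :* s :+ a :* a :* a :* b :* b :* b :* s

    -- Comm a b · U(s) · Comm′ a b · U(-s); its (1,2) entry is a b W(a, b, s)
    R : ∀ {n} → Polynomial n → Polynomial n → Polynomial n → Mat (Polynomial n)
    R a b s = mat
      (κ1 :+ :- (a :* b :* b :* s) :+ :- (a :* a :* b :* b :* b :* s) :+ :- (a :* a :* a :* b :* b :* b :* b :* s))
      (a :* b :* b :* s :* s :+ a :* a :* b :* b :* b :* s :* s :+ a :* a :* a :* b :* b :* b :* b :* s :* s :+ κ3 :* a :* a :* b :* b :* s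
        :+ κ2 :* a :* b :* s :+ κ2 :* a :* a :* a :* b :* b :* b :* s :+ a :* a :* a :* a :* b :* b :* b :* b :* s)
      (:- (a :* a :* b :* b :* b :* b :* s))
      (a :* a :* b :* b :* b :* b :* s :* s :+ a :* a :* a :* b :* b :* b :* b :* s :+ a :* a :* b :* b :* b :* s :+ a :* b :* b :* s :+ κ1)

    V : ∀ {n} → Polynomial n → Polynomial n → Polynomial n → Polynomial n
    V a b s = s :* s :+ a :* b :* s :* s :+ a :* a :* b :* b :* s :* s :+ κ3 :* a :* s :+ κ2 :* a :* a :* b :* s :+ a :* a :* a :* b :* b :* s

    -- templates over the variables g, h, t = ε^k, s = σ
    g h t s : Polynomial 4
    g = P.var fzero
    h = P.var (fsuc fzero)
    t = P.var (fsuc (fsuc fzero))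
    s = P.var (fsuc (fsuc (fsuc fzero)))

    a b : Polynomial 4
    a = :- (t :* t :* g)
    b = :- (t :* t :* h)

    -- the error ε^2k·G left in the output of the gadget
    G : Mat (Polynomial 4)
    G = mat (g :* h :* h :* V a b s)
            (s :* a :* b :* h :* (κ1 :+ a :* b :+ a :* a :* b :* b))
            (:- (h :* (s :* (a :* b :+ a :* a :* b :* b :+ a :* a :* a :* b :* b :* b) :+ s :* s :* a :* a :* b :* b :* b)))
            (t :* t :* a :* a :* b :* b :* b :* b :* s)

  module _ where
    open P using (solve; proveM; _:=_; _:*_; :-_; var; upperₚ; lowerₚ; _·ₚ_)
    open Templates using (Comm; Comm′; R; W)

    private
      x₀ : ∀ {n} → P.Polynomial (suc n)
      x₀ = var fzero
      y₀ : ∀ {n} → P.Polynomial (2 + n)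
      y₀ = var (fsuc fzero)
      z₀ : ∀ {n} → P.Polynomial (3 + n)
      z₀ = var (fsuc (fsuc fzero))

    commutator : ∀ x y → (P.upper x · (P.lower y · (P.upper (⊖ x) · P.lower (⊖ y)))) P.≈M ⟦ Comm x₀ y₀ ⟧M (x ∷ y ∷ [])
    commutator x y = proveM (x ∷ y ∷ []) (upperₚ x₀ ·ₚ (lowerₚ y₀ ·ₚ (upperₚ (:- x₀) ·ₚ lowerₚ (:- y₀)))) (Comm x₀ y₀)
      refl′ refl′ refl′ refl′

    commutator′ : ∀ x y → (P.lower y · (P.upper x · (P.lower (⊖ y) · P.upper (⊖ x)))) P.≈M ⟦ Comm′ x₀ y₀ ⟧M (x ∷ y ∷ [])
    commutator′ x y = proveM (x ∷ y ∷ []) (lowerₚ y₀ ·ₚ (upperₚ x₀ ·ₚ (lowerₚ (:- y₀) ·ₚ upperₚ (:- x₀)))) (Comm′ x₀ y₀)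
      refl′ refl′ refl′ refl′

    commutator-product : ∀ x y z → let ρ = x ∷ y ∷ z ∷ [] in
      (⟦ Comm x₀ y₀ ⟧M ρ · (P.upper z · (⟦ Comm′ x₀ y₀ ⟧M ρ · P.upper (⊖ z)))) P.≈M ⟦ R x₀ y₀ z₀ ⟧M ρ
    commutator-product x y z = proveM (x ∷ y ∷ z ∷ []) (Comm x₀ y₀ ·ₚ (upperₚ z₀ ·ₚ (Comm′ x₀ y₀ ·ₚ upperₚ (:- z₀))))
      (R x₀ y₀ z₀) refl′ refl′ refl′ refl′

    R₁₂-factor : ∀ x y z → Mat.m12 (⟦ R x₀ y₀ z₀ ⟧M (x ∷ y ∷ z ∷ [])) ≈P ((x ⊗ y) ⊗ P.⟦ W x₀ y₀ z₀ ⟧ (x ∷ y ∷ z ∷ []))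
    R₁₂-factor = solve 3 (λ x y z → Mat.m12 (R x y z) := (x :* y) :* W x y z) refl′

  replace+ : ∀ {j d e n X} Y → X P.≈M Y → ScaledDeg≤ 0 e Y → Approx j d n X → Approx j (d + e) n Y
  replace+ {d = d} {e} Y X≈Y degY A = replace Y X≈Y (ScaledDeg≤-mono Y (m≤n+m e d) degY) (weaken (m≤m+n d e) ≤-refl A)

  module Gadget (σ : K) (2σ+1≈0 : (σ +𝔽 σ) +𝔽 1# ≈𝔽 0#) (k : ℕ) (g h : PX) where
    module T = Templates

    ρ : Vec PEX 4
    ρ = embX g ∷ embX h ∷ powε k ∷ con σ ∷ []

    weight : Fin 4 → ℕ
    weight (fsuc (fsuc fzero)) = 1
    weight _                   = 0

    εdeg-ρ : ∀ i → εdeg (lookup ρ i) ≤ weight i * k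
    εdeg-ρ fzero                      = ≤-reflexive (εdeg-embX g)
    εdeg-ρ (fsuc fzero)               = ≤-reflexive (εdeg-embX h)
    εdeg-ρ (fsuc (fsuc fzero))        = ≤-reflexive (≡.trans (εdeg-powε k) (≡.sym (+-identityʳ k)))
    εdeg-ρ (fsuc (fsuc (fsuc fzero))) = z≤n

    degree-of : ∀ M → ScaledDeg≤ 0 (tdegM weight M * k) (⟦ M ⟧M ρ)
    degree-of = ScaledDeg≤-⟦⟧M weight k ρ εdeg-ρ

    a b s : PEX
    a = P.⟦ T.a ⟧ ρ
    b = P.⟦ T.b ⟧ ρ
    s = con σ

    private
      R₁₁ R₂₁ R₂₂ : P.Polynomial 4
      R₁₁ = Mat.m11 (T.R T.a T.b T.s)
      R₂₁ = Mat.m21 (T.R T.a T.b T.s)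
      R₂₂ = Mat.m22 (T.R T.a T.b T.s)

      Wρ y : PEX
      Wρ = P.⟦ T.W T.a T.b T.s ⟧ ρ
      y  = (embX g ⊗ embX h) ⊗ Wρ

      R₁₂≈ε⁴ᵏy : Mat.m12 (⟦ T.R T.a T.b T.s ⟧M ρ) ≈P ((powε (k + k) ⊗ powε (k + k)) ⊗ y)
      R₁₂≈ε⁴ᵏy = trans′ (R₁₂-factor a b s) (trans′
        (solve 4 (λ g h t w → ((:- (t :* t :* g)) :* (:- (t :* t :* h))) :* w := (t :* t) :* (t :* t) :* ((g :* h) :* w))
          refl′ (embX g) (embX h) (powε k) Wρ)
        (⊗-cong (⊗-cong (sym′ (powε-+ k k)) (sym′ (powε-+ k k))) refl′))
        where open P using (solve; _:=_; _:*_; :-_)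

    -- Modulo ε^2k this product is Q(-y), and -y = -g·h·W ≡ -2σ·g·h = g·h because W ≡ 2s modulo (a, b).
    rescaled·Q0≈ : (mat (P.⟦ R₁₁ ⟧ ρ) (⊖ y) (⊖ ((powε (k + k) ⊗ powε (k + k)) ⊗ P.⟦ R₂₁ ⟧ ρ)) (P.⟦ R₂₂ ⟧ ρ) · Q (con 0#))
                     P.≈M perturb (k + k) (Q (embX g ⊗ embX h)) (⟦ T.G ⟧M ρ)
    rescaled·Q0≈ = entry₁₁ , entry₁₂ , entry₂₁ , entry₂₂
      where
      open P using (prove; _:+_; _:*_; :-_; κ0; κ1)
      2s+1≈0 : ((s ⊕ s) ⊕ con 1#) ≈P con 0#
      2s+1≈0 = trans′ (sym′ (trans′ (con-+ _ _) (⊕-cong (con-+ σ σ) refl′))) (con-≈ 2σ+1≈0)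

      ε²ᵏ≈t² : powε (k + k) ≈P (powε k ⊗ powε k)
      ε²ᵏ≈t² = powε-+ k k

      yₜ : P.Polynomial 4
      yₜ = (T.g :* T.h) :* T.W T.a T.b T.s

      ε⁴ᵏR₂₁≈ : (⊖ ((powε (k + k) ⊗ powε (k + k)) ⊗ P.⟦ R₂₁ ⟧ ρ)) ≈P P.⟦ :- ((T.t :* T.t) :* (T.t :* T.t) :* R₂₁) ⟧ ρ
      ε⁴ᵏR₂₁≈ = ⊖-cong (⊗-cong (⊗-cong ε²ᵏ≈t² ε²ᵏ≈t²) refl′)

      entry₁₁ : (P.⟦ R₁₁ ⟧ ρ ⊗ con 0# ⊕ (⊖ y) ⊗ con 1#) ≈P ((embX g ⊗ embX h) ⊕ powε (k + k) ⊗ Mat.m11 (⟦ T.G ⟧M ρ))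
      entry₁₁ = trans′
        (prove ρ (R₁₁ :* κ0 :+ (:- yₜ) :* κ1) ((T.g :* T.h :+ (T.t :* T.t) :* Mat.m11 T.G) :+ ((T.s :+ T.s) :+ κ1) :* (:- (T.g :* T.h))) refl′)
        (trans′ (⊕-cong refl′ (trans′ (⊗-cong 2s+1≈0 refl′) (P.zeroˡ _)))
          (trans′ (⊕-id _) (⊕-cong refl′ (⊗-cong (sym′ ε²ᵏ≈t²) refl′))))

      entry₁₂ : (P.⟦ R₁₁ ⟧ ρ ⊗ con 1# ⊕ (⊖ y) ⊗ con 0#) ≈P (con 1# ⊕ powε (k + k) ⊗ Mat.m12 (⟦ T.G ⟧M ρ))
      entry₁₂ = trans′ (prove ρ (R₁₁ :* κ1 :+ (:- yₜ) :* κ0) (κ1 :+ (T.t :* T.t) :* Mat.m12 T.G) refl′)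
        (⊕-cong refl′ (⊗-cong (sym′ ε²ᵏ≈t²) refl′))

      entry₂₁ : ((⊖ ((powε (k + k) ⊗ powε (k + k)) ⊗ P.⟦ R₂₁ ⟧ ρ)) ⊗ con 0# ⊕ P.⟦ R₂₂ ⟧ ρ ⊗ con 1#)
                  ≈P (con 1# ⊕ powε (k + k) ⊗ Mat.m21 (⟦ T.G ⟧M ρ))
      entry₂₁ = trans′ (⊕-cong (⊗-cong ε⁴ᵏR₂₁≈ refl′) refl′) (trans′
        (prove ρ ((:- ((T.t :* T.t) :* (T.t :* T.t) :* R₂₁)) :* κ0 :+ R₂₂ :* κ1) (κ1 :+ (T.t :* T.t) :* Mat.m21 T.G) refl′)
        (⊕-cong refl′ (⊗-cong (sym′ ε²ᵏ≈t²) refl′)))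

      entry₂₂ : ((⊖ ((powε (k + k) ⊗ powε (k + k)) ⊗ P.⟦ R₂₁ ⟧ ρ)) ⊗ con 1# ⊕ P.⟦ R₂₂ ⟧ ρ ⊗ con 0#)
                  ≈P (con 0# ⊕ powε (k + k) ⊗ Mat.m22 (⟦ T.G ⟧M ρ))
      entry₂₂ = trans′ (⊕-cong (⊗-cong ε⁴ᵏR₂₁≈ refl′) refl′) (trans′
        (prove ρ ((:- ((T.t :* T.t) :* (T.t :* T.t) :* R₂₁)) :* κ1 :+ R₂₂ :* κ0) (κ0 :+ (T.t :* T.t) :* Mat.m22 T.G) refl′)
        (⊕-cong refl′ (⊗-cong (sym′ ε²ᵏ≈t²) refl′)))

    module _ {dA dB nA nB} (A : Approx (inputLevel k) dA nA (Q (embX g))) (B : Approx (inputLevel k) dB nB (Q (embX h))) where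
      Ua : Approx (middleLevel k) (dA + 10 * k) (7 + nA) (P.upper a)
      Ua = upperStep (embX g) (εdeg-embX g) A

      Ub : Approx (middleLevel k) (dB + 10 * k) (7 + nB) (P.upper b)
      Ub = upperStep (embX h) (εdeg-embX h) B

      Lb : Approx (middleLevel k) (dB + 10 * k) (7 + nB) (P.lower b)
      Lb = transposeᴬ Ub

      Uma : Approx (middleLevel k) (dA + 10 * k) (6 + (7 + nA)) (P.upper (⊖ a))
      Uma = negateUpper Ua

      Lmb : Approx (middleLevel k) (dB + 10 * k) (6 + (7 + nB)) (P.lower (⊖ b))
      Lmb = transposeᴬ (negateUpper Ub)

      Kab : Approx (middleLevel k) (2 * dA + 2 * dB + 48 * k) (2 * nA + 2 * nB + 40) (⟦ T.Comm T.a T.b ⟧M ρ)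
      Kab = weaken (≤-reflexive (degree-arith dA dB k)) (≤-reflexive (count-arith nA nB))
        (replace+ (⟦ T.Comm T.a T.b ⟧M ρ) (commutator a b) (degree-of (T.Comm T.a T.b)) (Ua ·ᴬ (Lb ·ᴬ (Uma ·ᴬ Lmb))))
        where
        degree-arith : ∀ dA dB k → (dA + 10 * k) + ((dB + 10 * k) + ((dA + 10 * k) + (dB + 10 * k))) + 8 * k ≡ 2 * dA + 2 * dB + 48 * k
        degree-arith = ℕ-Solver.solve-∀
        count-arith : ∀ nA nB → (7 + nA) + ((7 + nB) + ((6 + (7 + nA)) + (6 + (7 + nB)))) ≡ 2 * nA + 2 * nB + 40
        count-arith = ℕ-Solver.solve-∀

      Kba : Approx (middleLevel k) (2 * dA + 2 * dB + 48 * k) (2 * nA + 2 * nB + 40) (⟦ T.Comm′ T.a T.b ⟧M ρ)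
      Kba = weaken (≤-reflexive (degree-arith dA dB k)) (≤-reflexive (count-arith nA nB))
        (replace+ (⟦ T.Comm′ T.a T.b ⟧M ρ) (commutator′ a b) (degree-of (T.Comm′ T.a T.b)) (Lb ·ᴬ (Ua ·ᴬ (Lmb ·ᴬ Uma))))
        where
        degree-arith : ∀ dA dB k → (dB + 10 * k) + ((dA + 10 * k) + ((dB + 10 * k) + (dA + 10 * k))) + 8 * k ≡ 2 * dA + 2 * dB + 48 * k
        degree-arith = ℕ-Solver.solve-∀
        count-arith : ∀ nA nB → (7 + nB) + ((7 + nA) + ((6 + (7 + nB)) + (6 + (7 + nA)))) ≡ 2 * nA + 2 * nB + 40
        count-arith = ℕ-Solver.solve-∀

      Us : Approx (middleLevel k) (middleLevel k) 2 (P.upper s)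
      Us = exactUpper (polyCoef (con σ)) s (coefL-polyCoef _) z≤n ≤-refl

      Ums : Approx (middleLevel k) (middleLevel k) 2 (P.upper (⊖ s))
      Ums = exactUpper (polyCoef (con (𝔽.-_ σ))) (⊖ s) (trans′ (coefL-polyCoef _) (con-- σ)) z≤n ≤-refl

      Rab : Approx (middleLevel k) (4 * dA + 4 * dB + 124 * k) (4 * nA + 4 * nB + 84) (⟦ T.R T.a T.b T.s ⟧M ρ)
      Rab = weaken (≤-reflexive (degree-arith dA dB k)) (≤-reflexive (count-arith nA nB))
        (replace+ (⟦ T.R T.a T.b T.s ⟧M ρ) (commutator-product a b s) (degree-of (T.R T.a T.b T.s)) (Kab ·ᴬ (Us ·ᴬ (Kba ·ᴬ Ums))))
        where
        degree-arith : ∀ dA dB k → (2 * dA + 2 * dB + 48 * k) + (((k + k) + (k + k) + (k + k)) + ((2 * dA + 2 * dB + 48 * k) + ((k + k) + (k + k) + (k + k)))) + 16 * k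
                                   ≡ 4 * dA + 4 * dB + 124 * k
        degree-arith = ℕ-Solver.solve-∀
        count-arith : ∀ nA nB → (2 * nA + 2 * nB + 40) + (2 + ((2 * nA + 2 * nB + 40) + 2)) ≡ 4 * nA + 4 * nB + 84
        count-arith = ℕ-Solver.solve-∀

      private
        εdeg-y : εdeg y ≤ (4 * dA + 4 * dB + 124 * k + 12 * k) + ((k + k) + (k + k))
        εdeg-y = begin
          (εdeg (embX g) + εdeg (embX h)) + εdeg Wρ  ≡⟨ ≡.cong₂ (λ m n → (m + n) + εdeg Wρ) (εdeg-embX g) (εdeg-embX h) ⟩
          εdeg Wρ                                    ≤⟨ εdeg-⟦⟧ weight k ρ εdeg-ρ (T.W T.a T.b T.s) ⟩
          12 * k                                     ≤⟨ m≤n+m (12 * k) (4 * dA + 4 * dB + 124 * k) ⟩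
          4 * dA + 4 * dB + 124 * k + 12 * k         ≤⟨ m≤m+n _ _ ⟩
          (4 * dA + 4 * dB + 124 * k + 12 * k) + ((k + k) + (k + k)) ∎
          where open ≤-Reasoning

      Rescaled : Approx (k + k) (4 * dA + 4 * dB + 124 * k + 12 * k + ((k + k) + (k + k))) (6 + (4 * nA + 4 * nB + 84))
                   (mat (P.⟦ R₁₁ ⟧ ρ) (⊖ y) (⊖ ((powε (k + k) ⊗ powε (k + k)) ⊗ P.⟦ R₂₁ ⟧ ρ)) (P.⟦ R₂₂ ⟧ ρ))
      Rescaled = conjugateDown (k + k) (k + k) y R₁₂≈ε⁴ᵏy εdeg-y (weaken (m≤m+n _ (12 * k)) ≤-refl Rab)

      gadget : Approx (k + k) (4 * dA + 4 * dB + 158 * k) (4 * nA + 4 * nB + 91) (Q (embX g ⊗ embX h))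
      gadget = weaken (≤-reflexive (degree-arith dA dB k)) (≤-reflexive (count-arith nA nB))
        (adjust (Q (embX g ⊗ embX h)) (⟦ T.G ⟧M ρ) rescaled·Q0≈ degQ degG
          (weaken (m≤m+n _ ((k + k) + 14 * k)) ≤-refl (Rescaled ·ᴬ exactQ0 (k + k))))
        where
        degree-arith : ∀ dA dB k → (4 * dA + 4 * dB + 124 * k + 12 * k) + ((k + k) + (k + k)) + (k + k) + ((k + k) + 14 * k)
                                   ≡ 4 * dA + 4 * dB + 158 * k
        degree-arith = ℕ-Solver.solve-∀
        count-arith : ∀ nA nB → 6 + (4 * nA + 4 * nB + 84) + 1 ≡ 4 * nA + 4 * nB + 91
        count-arith = ℕ-Solver.solve-∀

        D₀ : ℕ
        D₀ = (4 * dA + 4 * dB + 124 * k + 12 * k) + ((k + k) + (k + k)) + (k + k)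

        degQ : ScaledDeg≤ 0 (D₀ + ((k + k) + 14 * k)) (Q (embX g ⊗ embX h))
        degQ = ≤-trans (≤-reflexive (≡.cong₂ _+_ (εdeg-embX g) (εdeg-embX h))) z≤n , z≤n , z≤n , z≤n

        degG : ScaledDeg≤ (k + k) (D₀ + ((k + k) + 14 * k)) (⟦ T.G ⟧M ρ)
        degG = let (p₁₁ , p₁₂ , p₂₁ , p₂₂) = degree-of T.G in bound p₁₁ , bound p₁₂ , bound p₂₁ , bound p₂₂
          where
          bound : ∀ {n} → n ≤ 14 * k → (k + k) + n ≤ D₀ + ((k + k) + 14 * k)
          bound p = ≤-trans (+-monoʳ-≤ (k + k) p) (m≤n+m _ D₀)

  -- Brent's balancing

  record Split (φ : Formula) (T : ℕ) : Set (c ⊔ˡ ℓ) where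
    field
      coeff sub rest : Formula
      eval≈      : eval φ ≈P (eval coeff ⊗ eval sub ⊕ eval rest)
      sub≤T      : size sub ≤ T
      T≤2sub     : T ≤ size sub + size sub
      coeff+sub≤ : size coeff + size sub ≤ size φ
      rest+sub≤  : size rest + size sub ≤ size φ

  open Split

  module _ {T : ℕ} where
    open Px using (solve; _:=_; _:+_; _:*_; κ0; κ1)

    split-plus : ∀ φ ψ → size ψ ≤ size φ → T < size (plus φ ψ) → (T < size φ → Split φ T) → Split (plus φ ψ) T
    split-plus φ ψ ψ≤φ (s≤s T≤φ+ψ) split-φ with size φ ≤? T
    ... | yes φ≤T = record
      { coeff = leafConst 1# ; sub = φ ; rest = ψ
      ; eval≈ = solve 2 (λ x y → x :+ y := κ1 :* x :+ y) refl′ (eval φ) (eval ψ)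
      ; sub≤T = φ≤T ; T≤2sub = ≤-trans T≤φ+ψ (+-monoʳ-≤ (size φ) ψ≤φ)
      ; coeff+sub≤ = s≤s (m≤m+n _ _)
      ; rest+sub≤ = ≤-trans (≤-reflexive (+-comm (size ψ) (size φ))) (n≤1+n _) }
    ... | no φ≰T = record
      { coeff = coeff d ; sub = sub d ; rest = plus (rest d) ψ
      ; eval≈ = trans′ (⊕-cong (eval≈ d) refl′)
          (solve 4 (λ a t b o → (a :* t :+ b) :+ o := a :* t :+ (b :+ o)) refl′ (eval (coeff d)) (eval (sub d)) (eval (rest d)) (eval ψ))
      ; sub≤T = sub≤T d ; T≤2sub = T≤2sub d
      ; coeff+sub≤ = ≤-trans (coeff+sub≤ d) (≤-trans (m≤m+n (size φ) (size ψ)) (n≤1+n _))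
      ; rest+sub≤ = ≤-trans (≤-reflexive (swap (size (rest d)) (size ψ) (size (sub d)))) (s≤s (+-monoˡ-≤ (size ψ) (rest+sub≤ d))) }
      where
      d : Split φ T
      d = split-φ (≰⇒> φ≰T)
      swap : ∀ b p t → suc (b + p) + t ≡ suc (b + t + p)
      swap = ℕ-Solver.solve-∀

    split-times : ∀ φ ψ → size ψ ≤ size φ → T < size (times φ ψ) → (T < size φ → Split φ T) → Split (times φ ψ) T
    split-times φ ψ ψ≤φ (s≤s T≤φ+ψ) split-φ with size φ ≤? T
    ... | yes φ≤T = record
      { coeff = ψ ; sub = φ ; rest = leafConst 0#
      ; eval≈ = solve 2 (λ x y → x :* y := y :* x :+ κ0) refl′ (eval φ) (eval ψ)
      ; sub≤T = φ≤T ; T≤2sub = ≤-trans T≤φ+ψ (+-monoʳ-≤ (size φ) ψ≤φ)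
      ; coeff+sub≤ = ≤-trans (≤-reflexive (+-comm (size ψ) (size φ))) (n≤1+n _)
      ; rest+sub≤ = s≤s (m≤m+n _ _) }
    ... | no φ≰T = record
      { coeff = times (coeff d) ψ ; sub = sub d ; rest = times (rest d) ψ
      ; eval≈ = trans′ (⊗-cong (eval≈ d) refl′)
          (solve 4 (λ a t b o → (a :* t :+ b) :* o := (a :* o) :* t :+ b :* o) refl′ (eval (coeff d)) (eval (sub d)) (eval (rest d)) (eval ψ))
      ; sub≤T = sub≤T d ; T≤2sub = T≤2sub d
      ; coeff+sub≤ = ≤-trans (≤-reflexive (swap (size (coeff d)) (size ψ) (size (sub d)))) (s≤s (+-monoˡ-≤ (size ψ) (coeff+sub≤ d)))
      ; rest+sub≤ = ≤-trans (≤-reflexive (swap (size (rest d)) (size ψ) (size (sub d)))) (s≤s (+-monoˡ-≤ (size ψ) (rest+sub≤ d))) }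
      where
      d : Split φ T
      d = split-φ (≰⇒> φ≰T)
      swap : ∀ b p t → suc (b + p) + t ≡ suc (b + t + p)
      swap = ℕ-Solver.solve-∀

    private
      suc-+-comm : ∀ m n → suc (m + n) ≡ suc (n + m)
      suc-+-comm m n = ≡.cong suc (+-comm m n)

      swapSplit : ∀ {φ φ′} → eval φ ≈P eval φ′ → size φ ≡ size φ′ → Split φ′ T → Split φ T
      swapSplit e≈ s≡ d = record
        { coeff = coeff d ; sub = sub d ; rest = rest d
        ; eval≈ = trans′ e≈ (eval≈ d) ; sub≤T = sub≤T d ; T≤2sub = T≤2sub d
        ; coeff+sub≤ = ≤-trans (coeff+sub≤ d) (≤-reflexive (≡.sym s≡))
        ; rest+sub≤ = ≤-trans (rest+sub≤ d) (≤-reflexive (≡.sym s≡)) }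

    -- Descend into the larger child until it has size at most T.
    split : ∀ φ → 1 ≤ T → T < size φ → Split φ T
    split (leafVar _)   (s≤s z≤n) (s≤s ())
    split (leafConst _) (s≤s z≤n) (s≤s ())
    split (plus φ ψ) 1≤T T<φψ with size ψ ≤? size φ
    ... | yes ψ≤φ = split-plus φ ψ ψ≤φ T<φψ (split φ 1≤T)
    ... | no ψ≰φ  = swapSplit (⊕-comm _ _) (suc-+-comm (size φ) (size ψ))
      (split-plus ψ φ (<⇒≤ (≰⇒> ψ≰φ)) (≤-trans T<φψ (≤-reflexive (suc-+-comm (size φ) (size ψ)))) (split ψ 1≤T))
    split (times φ ψ) 1≤T T<φψ with size ψ ≤? size φ
    ... | yes ψ≤φ = split-times φ ψ ψ≤φ T<φψ (split φ 1≤T)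
    ... | no ψ≰φ  = swapSplit (⊗-comm _ _) (suc-+-comm (size φ) (size ψ))
      (split-times ψ φ (<⇒≤ (≰⇒> ψ≰φ)) (≤-trans T<φψ (≤-reflexive (suc-+-comm (size φ) (size ψ)))) (split ψ 1≤T))

  infixl 6 _+ᵇ_
  infixl 7 _*ᵇ_

  data Bal : Set c where
    varᵇ   : ℕ → Bal
    constᵇ : K → Bal
    _+ᵇ_   : Bal → Bal → Bal
    _*ᵇ_   : Bal → Bal → Bal

  ⟦_⟧ᵇ : Bal → PX
  ⟦ varᵇ i ⟧ᵇ   = var i
  ⟦ constᵇ x ⟧ᵇ = con x
  ⟦ a +ᵇ b ⟧ᵇ   = ⟦ a ⟧ᵇ ⊕ ⟦ b ⟧ᵇ
  ⟦ a *ᵇ b ⟧ᵇ   = ⟦ a ⟧ᵇ ⊗ ⟦ b ⟧ᵇ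

  -- bounds both the number of Q-matrices and the ε-degree divided by k in translate b k
  cost : Bal → ℕ
  cost (varᵇ _)   = 2
  cost (constᵇ _) = 2
  cost (a +ᵇ b)   = cost a + cost b + 2
  cost (a *ᵇ b)   = 16 * (cost a + cost b) + 158

  record Balanced (φ : Formula) : Set (c ⊔ˡ ℓ) where
    field
      tree   : Bal
      tree≈  : ⟦ tree ⟧ᵇ ≈P eval φ
      cost≤  : cost tree ≤ sizeBound (size φ)

  open Balanced

  1≤size : ∀ φ → 1 ≤ size φ
  1≤size (leafVar _)   = s≤s z≤n
  1≤size (leafConst _) = s≤s z≤n
  1≤size (plus _ _)    = s≤s z≤n
  1≤size (times _ _)   = s≤s z≤n

  cost-splitNode : ∀ {x} a t b → cost a ≤ x → cost t ≤ x → cost b ≤ x → cost (a *ᵇ t +ᵇ b) ≤ 33 * x + 160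
  cost-splitNode {x} a t b a≤x t≤x b≤x = begin
    16 * (cost a + cost t) + 158 + cost b + 2  ≤⟨ +-monoˡ-≤ 2 (+-mono-≤ (+-monoˡ-≤ 158 (*-monoʳ-≤ 16 (+-mono-≤ a≤x t≤x))) b≤x) ⟩
    16 * (x + x) + 158 + x + 2                 ≡⟨ collect x ⟩
    33 * x + 160                               ∎
    where
    open ≤-Reasoning
    collect : ∀ x → 16 * (x + x) + 158 + x + 2 ≡ 33 * x + 160
    collect = ℕ-Solver.solve-∀

  module _ (n : ℕ) {φ} (|φ|≡S : size φ ≡ 2 + n) where
    open Halving n

    largestPart : Split φ T → ℕ
    largestPart d = size (coeff d) ⊔ size (sub d) ⊔ size (rest d)

    4·largestPart≤3S : ∀ d → 4 * largestPart d ≤ 3 * size φ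
    4·largestPart≤3S d = begin
      4 * (|coeff| ⊔ |sub| ⊔ |rest|)              ≡⟨ ≡.trans (*-distribˡ-⊔ 4 (|coeff| ⊔ |sub|) |rest|)
                                                      (≡.cong (_⊔ 4 * |rest|) (*-distribˡ-⊔ 4 |coeff| |sub|)) ⟩
      4 * |coeff| ⊔ 4 * |sub| ⊔ 4 * |rest|        ≤⟨ ⊔-lub (⊔-lub (small-rest |coeff| |sub| (≤S (coeff+sub≤ d)) (T≤2sub d))
                                                                (small-sub |sub| (sub≤T d)))
                                                        (small-rest |rest| |sub| (≤S (rest+sub≤ d)) (T≤2sub d)) ⟩
      3 * S                                       ≡⟨ ≡.cong (3 *_) (≡.sym |φ|≡S) ⟩
      3 * size φ                                  ∎
      where
      open ≤-Reasoning
      |coeff| |sub| |rest| : ℕ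
      |coeff| = size (coeff d)
      |sub|   = size (sub d)
      |rest|  = size (rest d)
      ≤S : ∀ {x} → x ≤ size φ → x ≤ S
      ≤S p = ≤-trans p (≤-reflexive |φ|≡S)

    balanceNode : (∀ ψ → size ψ < size φ → Balanced ψ) → Balanced φ
    balanceNode balanced-below = record
      { tree  = tree A *ᵇ tree t +ᵇ tree B
      ; tree≈ = trans′ (⊕-cong (⊗-cong (tree≈ A) (tree≈ t)) (tree≈ B)) (sym′ (eval≈ d))
      ; cost≤ = ≤-trans (cost-splitNode (tree A) (tree t) (tree B) (bounded A |coeff|≤m) (bounded t |sub|≤m) (bounded B |rest|≤m))
                        (sizeBound-step m (size φ) (4·largestPart≤3S d) (1≤size φ)) }
      where
      T<|φ| : T < size φ
      T<|φ| = ≤-trans T<S (≤-reflexive (≡.sym |φ|≡S))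
      d : Split φ T
      d = split φ 1≤T T<|φ|
      m : ℕ
      m = largestPart d
      |coeff|≤m : size (coeff d) ≤ m
      |coeff|≤m = ≤-trans (m≤m⊔n _ (size (sub d))) (m≤m⊔n _ (size (rest d)))
      |sub|≤m : size (sub d) ≤ m
      |sub|≤m = ≤-trans (m≤n⊔m (size (coeff d)) _) (m≤m⊔n _ (size (rest d)))
      |rest|≤m : size (rest d) ≤ m
      |rest|≤m = m≤n⊔m (size (coeff d) ⊔ size (sub d)) _
      below : ∀ {x} → x + size (sub d) ≤ size φ → x < size φ
      below {x} p = ≤-trans (≤-trans (≤-reflexive (+-comm 1 x)) (+-monoʳ-≤ x (1≤size (sub d)))) p
      A t B : Balanced _
      A = balanced-below (coeff d) (below (coeff+sub≤ d))
      t = balanced-below (sub d) (≤-trans (s≤s (sub≤T d)) T<|φ|)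
      B = balanced-below (rest d) (below (rest+sub≤ d))
      bounded : ∀ {ψ} (b : Balanced ψ) → size ψ ≤ m → cost (tree b) ≤ sizeBound m
      bounded b le = ≤-trans (cost≤ b) (sizeBound-mono le)

  node-size : ∀ φ ψ → suc (size φ + size ψ) ≡ 2 + (ℕ.pred (size φ) + size ψ)
  node-size φ ψ = ≡.cong suc (≡.cong (_+ size ψ) (≡.sym (suc-pred (size φ) {{ℕ.>-nonZero (1≤size φ)}})))

  balance : ∀ φ → Balanced φ
  balance φ = go φ (<-wellFounded (size φ))
    where
    go : ∀ φ → Acc _<_ (size φ) → Balanced φ
    go (leafVar i)   _ = record { tree = varᵇ i ; tree≈ = refl′ ; cost≤ = 2≤sizeBound 1 (s≤s z≤n) }
    go (leafConst x) _ = record { tree = constᵇ x ; tree≈ = refl′ ; cost≤ = 2≤sizeBound 1 (s≤s z≤n) }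
    go (plus φ ψ)  (acc below) = balanceNode (ℕ.pred (size φ) + size ψ) (node-size φ ψ) (λ χ lt → go χ (below lt))
    go (times φ ψ) (acc below) = balanceNode (ℕ.pred (size φ) + size ψ) (node-size φ ψ) (λ χ lt → go χ (below lt))

  module Translation (σ : K) (2σ+1≈0 : (σ +𝔽 σ) +𝔽 1# ≈𝔽 0#) where

    private
      k+k≡k*2 : ∀ k → k + k ≡ k * 2
      k+k≡k*2 = ℕ-Solver.solve-∀

    translate : ∀ (b : Bal) k → Approx (k + k) (k * cost b) (cost b) (Q (embX ⟦ b ⟧ᵇ))
    translate (varᵇ i) k = weaken (≤-reflexive (k+k≡k*2 k)) (s≤s z≤n)
      (exactQ (varAffine i) (var (x′ i)) (affineL-varAffine i) z≤n ≤-refl)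
    translate (constᵇ x) k = weaken (≤-reflexive (k+k≡k*2 k)) (s≤s z≤n)
      (exactQ (constAffine (polyCoef (con x))) (con x) (trans′ (⊕-id _) (coefL-polyCoef _)) z≤n ≤-refl)
    translate (a +ᵇ b) k = weaken (≤-reflexive (degree-arith k (cost a) (cost b))) count≤
      (replace (Q (embX ⟦ a ⟧ᵇ ⊕ embX ⟦ b ⟧ᵇ)) (P.Q-Q0-Q _ _) (εdeg-sum , z≤n , z≤n , z≤n)
        (translate a k ·ᴬ exactQ0 (k + k) ·ᴬ translate b k))
      where
      εdeg-sum : εdeg (embX ⟦ a ⟧ᵇ ⊕ embX ⟦ b ⟧ᵇ) ≤ k * cost a + (k + k) + k * cost b
      εdeg-sum = ≤-trans (≤-reflexive (≡.cong₂ _⊔_ (εdeg-embX ⟦ a ⟧ᵇ) (εdeg-embX ⟦ b ⟧ᵇ))) z≤n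
      degree-arith : ∀ k x y → k * x + (k + k) + k * y ≡ k * (x + y + 2)
      degree-arith = ℕ-Solver.solve-∀
      count≤ : cost a + 1 + cost b ≤ cost a + cost b + 2
      count≤ = ≤-trans (≤-reflexive (+-comm-middle (cost a) (cost b))) (+-monoʳ-≤ (cost a + cost b) (s≤s z≤n))
        where
        +-comm-middle : ∀ x y → x + 1 + y ≡ x + y + 1
        +-comm-middle = ℕ-Solver.solve-∀
    translate (a *ᵇ b) k = weaken (≤-reflexive (degree-arith k (cost a) (cost b))) count≤
      (Gadget.gadget σ 2σ+1≈0 k ⟦ a ⟧ᵇ ⟦ b ⟧ᵇ (at-inputLevel (translate a k₄)) (at-inputLevel (translate b k₄)))
      where
      k₄ : ℕ
      k₄ = k + k + (k + k)
      at-inputLevel : ∀ {d n X} → Approx (k₄ + k₄) d n X → Approx (inputLevel k) d n X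
      at-inputLevel {d} {n} {X} = ≡.subst (λ j → Approx j d n X) (level-arith k)
        where
        level-arith : ∀ k → (k + k + (k + k)) + (k + k + (k + k)) ≡ k + k + ((k + k) + (k + k) + (k + k))
        level-arith = ℕ-Solver.solve-∀
      degree-arith : ∀ k x y → 4 * ((k + k + (k + k)) * x) + 4 * ((k + k + (k + k)) * y) + 158 * k ≡ k * (16 * (x + y) + 158)
      degree-arith = ℕ-Solver.solve-∀
      count≤ : 4 * cost a + 4 * cost b + 91 ≤ 16 * (cost a + cost b) + 158
      count≤ = ≤-trans (≤-reflexive (≡.cong (_+ 91) (≡.sym (*-distribˡ-+ 4 (cost a) (cost b)))))
        (+-mono-≤ (*-monoˡ-≤ (cost a + cost b) (m≤m+n 4 12)) (m≤m+n 91 67))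

  minusHalf : CharNot2 F → Σ K λ σ → (σ +𝔽 σ) +𝔽 1# ≈𝔽 0#
  minusHalf char≢2 = 𝔽.- half , (begin
    (𝔽.- half 𝔽.+ 𝔽.- half) 𝔽.+ 1#   ≈⟨ 𝔽.+-congʳ (-‿+-comm half half) ⟩
    𝔽.- (half 𝔽.+ half) 𝔽.+ 1#       ≈⟨ 𝔽.+-congʳ (𝔽.-‿cong half+half≈1) ⟩
    𝔽.- 1# 𝔽.+ 1#                    ≈⟨ 𝔽.-‿inverseˡ 1# ⟩
    0#                               ∎)
    where
    open import Algebra.Properties.Ring 𝔽.ring using (-‿+-comm)
    open import Relation.Binary.Reasoning.Setoid 𝔽.setoid
    half : K
    half = proj₁ (𝔽.inverse (1# 𝔽.+ 1#) char≢2)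
    half+half≈1 : half 𝔽.+ half ≈𝔽 1#
    half+half≈1 = 𝔽.trans (𝔽.sym (𝔽.trans (𝔽.distribʳ half 1# 1#) (𝔽.+-cong (𝔽.*-identityˡ half) (𝔽.*-identityˡ half))))
                          (proj₂ (𝔽.inverse (1# 𝔽.+ 1#) char≢2))

  Certificate : ℕ → PX → Set (c ⊔ˡ ℓ)
  Certificate B f = Σ (Mat PEX) λ M → M ∈ Q (embX f) +Oε × ErrorDeg≤ B M ×
    Σ ℕ λ k → Σ (Fin k → Affine) λ ls → k ≤ B × MatRel _≈L_ (prodMat k (λ i → primQ (ls i))) (mapMat embEX M)

  certificate : ∀ {d n B p f} → Approx 2 d n (Q (embX p)) → p ≈P f → d ≤ B → n ≤ B → Certificate B f
  certificate {p = p} (approx As count≤n E@(mat e₁₁ e₁₂ e₂₁ e₂₂) product≈ degQ degE) p≈f d≤B n≤B =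
    perturb 2 (Q (embX p)) E ,
    (powε 2 ⊡ E , (inOε e₁₁ , inOε e₁₂ , inOε e₂₁ , inOε e₂₂) , (⊕-cong (embX-cong p≈f) refl′ , refl′ , refl′ , refl′)) ,
    (let (q₁₁ , q₁₂ , q₂₁ , q₂₂) = εdeg-perturb (Q (embX p)) E degQ degE in
      εdeg≤⇒EpsDeg≤ _ (≤-trans q₁₁ d≤B) , εdeg≤⇒EpsDeg≤ _ (≤-trans q₁₂ d≤B) ,
      εdeg≤⇒EpsDeg≤ _ (≤-trans q₂₁ d≤B) , εdeg≤⇒EpsDeg≤ _ (≤-trans q₂₂ d≤B)) ,
    _ , lookup As , ≤-trans count≤n n≤B ,
    ≡.subst (λ Z → Z L.≈M mapMat embEX (perturb 2 (Q (embX p)) E)) (≡.sym (prodMat-lookup As)) product≈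
    where
    inOε : ∀ e → InOε (powε 2 ⊗ e)
    inOε e = powε 1 ⊗ e , ⊗-assoc _ _ _

  formula-certificate : CharNot2 F → ∀ {B f} φ → sizeBound (size φ) ≤ B → eval φ ≈P f → Certificate B f
  formula-certificate char≢2 {B} φ bound≤B φ≈f =
    certificate (Translation.translate σ 2σ+1≈0 (tree b) 1) (trans′ (tree≈ b) φ≈f)
      (≤-trans (≤-reflexive (*-identityˡ (cost (tree b)))) cost≤B) cost≤B
    where
    b : Balanced φ
    b = balance φ
    cost≤B : cost (tree b) ≤ B
    cost≤B = ≤-trans (cost≤ b) bound≤B
    σ : K
    σ = proj₁ (minusHalf char≢2)
    2σ+1≈0 : (σ +𝔽 σ) +𝔽 1# ≈𝔽 0#
    2σ+1≈0 = proj₂ (minusHalf char≢2)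

proposition3p6 : ∀ {c ℓ : Level} (F : Field c ℓ) → CharNot2 F →
    let open Over F in
    (f : ℕ → PX) → VPe f →
    Σ (ℕ → ℕ) λ p → Σ (ℕ → ℕ) λ q → PolyBounded p × PolyBounded q ×
      (∀ n → Σ (Mat PEX) λ M →
        M ∈ Q (embX (f n)) +Oε ×
        ErrorDeg≤ (q n) M ×
        Σ ℕ λ k → Σ (Fin k → Affine) λ ls →
          k ≤ p n × MatRel _≈L_ (prodMat k (λ i → primQ (ls i))) (mapMat embEX M))
proposition3p6 F char≢2 f (_ , s , _ , s-poly , formulas) =
  bound , bound , PolyBounded-sizeBound s s-poly , PolyBounded-sizeBound s s-poly ,
  λ n → let (φ , |φ|≤s , _ , eval≈f) = formulas n in formula-certificate F char≢2 φ (sizeBound-mono |φ|≤s) eval≈f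
  where
  open Construction using (formula-certificate)
  bound : ℕ → ℕ
  bound n = sizeBound (s n)
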